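{- Let $w=w_1w_2\cdots w_f$ be a word of length $f$ in the alphabet $\Gamma_n$, and let $\tilde w=\tilde w_1\tilde w_2\cdots\tilde w_f$ be its standardization. Suppose $w$ corresponds to $(P,Q)$ under Berele's correspondence and $\tilde w$ corresponds to $(\tilde P,\tilde Q)$ under standardized Berele's correspondence. For each $\gamma\in\Gamma_n$ let $c_w(\gamma)$ be the number of letters $\gamma$ removed in cancellations during the computation of Berele's correspondence applied to $w$ (so that $c_w(k)=c_w(\bar k)$ for every $k\in[1,n]$ and $\sum_{\gamma\in\Gamma_n}c_w(\gamma)=2\sum_{k=1}^n c_w(k)=f-|\mathrm{sh}(P)|$). Then $\tilde Q=Q$, and $\tilde P$ is obtained from $P$ by replacing, for each $\gamma\in\Gamma_n$, the occurrences of the letter $\gamma$ in $P$ (which form a horizontal strip) by the letters $\gamma_{c_w(\gamma)+1},\gamma_{c_w(\gamma)+2},\dots,\gamma_{m_w(\gamma)}$ in this order from left to right.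
   Context: Partitions are identified with their Young diagrams $D_\lambda=\{(i,j):1\le i\le \ell(\lambda),\,1\le j\le\lambda_i\}$ (matrix coordinates: row $i$, column $j$); $|\lambda|$ is the number of cells. Fix $n\ge1$ and the totally ordered alphabet $\Gamma_n=\{1<\bar1<2<\bar2<\cdots<n<\bar n\}$. A tableau of shape $\lambda$ is a map from $D_\lambda$ to an alphabet; it is semistandard if rows weakly increase left to right and columns strictly increase top to bottom. An $Sp(2n)$-tableau is a semistandard tableau with entries in $\Gamma_n$ such that every entry in row $i$ is $\ge i$ (the unbarred letter $i$). Row insertion $T\leftarrow x$: insert $x$ into row 1: if some entry of the row is strictly larger than $x$, the leftmost such entry is replaced by $x$ and is bumped and inserted into the next row in the same way; otherwise $x$ is appended at the end of the row (possibly creating a new row). Jeu de taquin: given a tableau with a hole at cell $(i,j)$, if $(i+1,j)$ is in the shape and either $(i,j+1)$ is not in the shape or $T(i+1,j)\le T(i,j+1)$, move the entry of $(i+1,j)$ into the hole and make $(i+1,j)$ the hole; otherwise move the entry of $(i,j+1)$ into the hole and make $(i,j+1)$ the hole; repeat until neither $(i+1,j)$ nor $(i,j+1)$ is in the shape, then delete the hole cell from the shape. Berele insertion $T\leftarrow_{\mathcal B} x$ ($T$ an $Sp(2n)$-tableau, $x\in\Gamma_n$): perform the row insertion of $x$ into $T$; if the result is an $Sp(2n)$-tableau, that is the result. Otherwise, at the earliest stage where a letter $\bar k$ that was in row $k$ is bumped by a letter $k$, erase both this $k$ and this $\bar k$ (a cancellation of the pair $k$-$\bar k$), leaving the position formerly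 occupied by $\bar k$ as a hole, and slide the hole by jeu de taquin until it leaves the shape. Berele's correspondence: for a word $w=w_1\cdots w_f$ in $\Gamma_n$ put $P_i=(\cdots((\varnothing\leftarrow_{\mathcal B}w_1)\leftarrow_{\mathcal B}w_2)\cdots)\leftarrow_{\mathcal B}w_i$; then $P=P_f$ (the $P$-symbol) and $Q=(\mathrm{sh}(P_0),\dots,\mathrm{sh}(P_f))$ (the $Q$-symbol). Standardization: $m_w(\gamma)$ is the number of occurrences of $\gamma$ in $w$; $\tilde w$ is obtained by replacing the occurrences of each $\gamma$ by $\gamma_1,\gamma_2,\dots,\gamma_{m_w(\gamma)}$ from left to right. $\tilde\Gamma_w=\{\gamma_s:\gamma\in\Gamma_n,1\le s\le m_w(\gamma)\}$ is totally ordered by $\gamma_s<\delta_t$ iff $\gamma<\delta$, or $\gamma=\delta$ and $s<t$. Standardized Berele insertion $T\leftarrow_{\tilde{\mathcal B}} x$ (entries and $x$ in $\tilde\Gamma_w$): bumping and sliding use the order of $\tilde\Gamma_w$. Perform row insertion; if at some stage a letter $k_s$ ($k\in[1,n]$) bumps a letter $\bar k_t$ out of row $k$, say from cell $(k,c)$, then at the first such stage place $k_s$ in $(k,c)$, discard $\bar k_t$ (do not insert it into row $k+1$), remove the entry of cell $(k,1)$ (a letter $k_u$, the smallest $k$ present) leaving a hole there, and slide this hole by jeu de taquin until it leaves the shape. If no such stage occurs, the result is the ordinary row insertion. Standardized Berele's correspondence applies this iteratively to $\tilde w$ starting from $\varnothing$, yielding $\tilde P$ and the sequence of shapes $\tilde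 Q$. -}

module Defs where

open import Data.Nat using (ℕ; zero; suc; _+_; _<ᵇ_; _≡ᵇ_; _≤ᵇ_)
open import Data.Bool using (Bool; true; false; not; _∧_; _∨_; if_then_else_)
open import Data.List using (List; []; _∷_; _++_; length; map; take; drop)
open import Data.Nat.ListAction using (sum)
open import Data.Maybe using (Maybe; just; nothing)
open import Data.Product using (_×_; _,_; proj₁; proj₂)
open import Data.Fin using (Fin; toℕ)

-- The alphabet Γ_n = {1 < 1̄ < 2 < 2̄ < ... < n < n̄}.
-- A letter is (i , b) with i : Fin n; it denotes the letter k = toℕ i + 1,
-- unbarred if b = false and barred (k̄) if b = true.

Γ : ℕ → Set
Γ n = Fin n × Bool

code : ∀ {n} → Γ n → ℕ
code (i , b) = toℕ i + toℕ i + (if b then 1 else 0)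

letterNum : ∀ {n} → Γ n → ℕ
letterNum (i , _) = suc (toℕ i)

_<Γ_ : ∀ {n} → Γ n → Γ n → Bool
x <Γ y = code x <ᵇ code y

_==Γ_ : ∀ {n} → Γ n → Γ n → Bool
x ==Γ y = code x ≡ᵇ code y

-- Standardized alphabet: γ_s is (γ , s), s ≥ 1.
Γ~ : ℕ → Set
Γ~ n = Γ n × ℕ

_<Γ~_ : ∀ {n} → Γ~ n → Γ~ n → Bool
(γ , s) <Γ~ (δ , t) = (γ <Γ δ) ∨ ((γ ==Γ δ) ∧ (s <ᵇ t))

-- Tableaux are lists of rows (row 1 first), each row listed left to right.

Tableau : Set → Set
Tableau A = List (List A)

Shape : Set
Shape = List ℕ

sh : ∀ {A : Set} → Tableau A → Shape
sh = map length

countB : ∀ {A : Set} → (A → Bool) → List A → ℕ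
countB p [] = 0
countB p (x ∷ xs) = (if p x then 1 else 0) + countB p xs

allB : ∀ {A : Set} → (A → Bool) → List A → Bool
allB p [] = true
allB p (x ∷ xs) = p x ∧ allB p xs

-- add a row on top unless it is empty (removing an emptied row from the shape)
cons? : ∀ {A : Set} → List A → Tableau A → Tableau A
cons? [] t = t
cons? (x ∷ r) t = (x ∷ r) ∷ t

module Ops {A : Set} (_<_ : A → A → Bool) where

  _≤_ : A → A → Bool
  a ≤ b = not (b < a)

  bump : A → List A → Maybe (List A × A × List A)
  bump x [] = nothing
  bump x (y ∷ ys) with x < y
  ... | true = just ([] , y , ys)
  ... | false with bump x ys
  ...   | nothing = nothing
  ...   | just (p , z , s) = just (y ∷ p , z , s)

  rowInsert : Tableau A → A → Tableau A
  rowInsert [] x = (x ∷ []) ∷ []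
  rowInsert (r ∷ rs) x with bump x r
  ... | nothing = (r ++ x ∷ []) ∷ rs
  ... | just (p , y , s) = (p ++ x ∷ s) ∷ rowInsert rs y

  -- jeu de taquin: the current row is  bef ++ [hole] ++ aft , 'below' are the
  -- rows underneath.  The hole is in column (length bef + 1).
  mutual
    slide : List A → List A → Tableau A → Tableau A
    slide bef [] [] = cons? bef []
    slide bef (a ∷ aft) [] = slide (bef ++ a ∷ []) aft []
    slide bef aft below@(r ∷ rs) = slideB bef aft below r rs (drop (length bef) r)

    -- last argument: the part of the next row starting at the hole's column
    slideB : List A → List A → Tableau A → List A → Tableau A → List A → Tableau A
    slideB bef [] below r rs [] = cons? bef below
    slideB bef (a ∷ aft) below r rs [] = slide (bef ++ a ∷ []) aft below
    slideB bef [] below r rs (b ∷ r') =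
      (bef ++ b ∷ []) ∷ slide (take (length bef) r) r' rs
    slideB bef (a ∷ aft) below r rs (b ∷ r') with b ≤ a
    ... | true = (bef ++ b ∷ a ∷ aft) ∷ slide (take (length bef) r) r' rs
    ... | false = slide (bef ++ a ∷ []) aft below

  -- row insertion of x into the rows (current row index k), stopping at the
  -- first stage where 'canc k x y' holds (x bumps y out of row k); then the
  -- action 'act x pre suf below' (row k was pre ++ y ∷ suf) replaces row k and
  -- everything below.  Also returns the inserted letter that caused the
  -- cancellation, if any.
  cancelInsert : (ℕ → A → A → Bool) →
                 (A → List A → List A → Tableau A → Tableau A) →
                 ℕ → Tableau A → A → Tableau A × Maybe A
  cancelInsert canc act k [] x = ((x ∷ []) ∷ []) , nothing
  cancelInsert canc act k (r ∷ rs) x with bump x r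
  ... | nothing = ((r ++ x ∷ []) ∷ rs) , nothing
  ... | just (p , y , s) with canc k x y
  ...   | true = act x p s rs , just x
  ...   | false with cancelInsert canc act (suc k) rs y
  ...     | (t , m) = ((p ++ x ∷ s) ∷ t) , m

  -- semistandard: shape is a partition (nonempty rows of weakly decreasing
  -- length), rows weakly increase, columns strictly increase
  weakRow : List A → Bool
  weakRow [] = true
  weakRow (a ∷ []) = true
  weakRow (a ∷ b ∷ r) = (a ≤ b) ∧ weakRow (b ∷ r)

  strictCols : List A → List A → Bool
  strictCols (a ∷ r) (b ∷ s) = (a < b) ∧ strictCols r s
  strictCols [] (b ∷ s) = false
  strictCols _ [] = true

  semistandard : Tableau A → Bool
  semistandard [] = true
  semistandard ([] ∷ rs) = false
  semistandard (r ∷ []) = weakRow r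
  semistandard (r ∷ r' ∷ rs) = weakRow r ∧ strictCols r r' ∧ semistandard (r' ∷ rs)

module _ {n : ℕ} where
  open Ops (_<Γ_ {n})

  rowCond : ℕ → Tableau (Γ n) → Bool
  rowCond k [] = true
  rowCond k (r ∷ rs) = allB (λ x → k ≤ᵇ letterNum x) r ∧ rowCond (suc k) rs

  isSp : Tableau (Γ n) → Bool
  isSp T = semistandard T ∧ rowCond 1 T

  cancB : ℕ → Γ n → Γ n → Bool
  cancB k (i , b) (j , c) = not b ∧ c ∧ (toℕ i ≡ᵇ toℕ j) ∧ (letterNum (i , b) ≡ᵇ k)

  -- erase the k and the k̄; the k̄'s cell is a hole slid out by jeu de taquin
  actB : Γ n → List (Γ n) → List (Γ n) → Tableau (Γ n) → Tableau (Γ n)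
  actB x pre suf below = slide pre suf below

  bereleIns : Tableau (Γ n) → Γ n → Tableau (Γ n) × Maybe (Γ n)
  bereleIns T x with isSp (rowInsert T x)
  ... | true = rowInsert T x , nothing
  ... | false = cancelInsert cancB actB 1 T x

  -- run from a tableau; returns final tableau, shapes after each step,
  -- and the list of unbarred letters k of the cancelled pairs k-k̄
  bereleRun : Tableau (Γ n) → List (Γ n) → Tableau (Γ n) × List Shape × List (Γ n)
  bereleRun T [] = T , [] , []
  bereleRun T (x ∷ xs) with bereleIns T x
  ... | (T' , m) with bereleRun T' xs
  ...   | (P , shs , cs) = P , sh T' ∷ shs , addC m cs
    where
    addC : Maybe (Γ n) → List (Γ n) → List (Γ n)
    addC nothing cs = cs
    addC (just k) cs = k ∷ cs

  bereleP : List (Γ n) → Tableau (Γ n)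
  bereleP w = proj₁ (bereleRun [] w)

  bereleQ : List (Γ n) → List Shape
  bereleQ w = sh {Γ n} [] ∷ proj₁ (proj₂ (bereleRun [] w))

  -- c_w(γ): number of letters γ removed in cancellations; each cancellation
  -- removes exactly one k and one k̄, so c_w(k) = c_w(k̄) = #cancellations of k.
  cancelCount : List (Γ n) → Γ n → ℕ
  cancelCount w (i , b) = countB (λ k → (i , false) ==Γ k) (proj₂ (proj₂ (bereleRun [] w)))

  mult : List (Γ n) → Γ n → ℕ
  mult w γ = countB (γ ==Γ_) w

  standardizeFrom : List (Γ n) → List (Γ n) → List (Γ~ n)
  standardizeFrom seen [] = []
  standardizeFrom seen (x ∷ xs) =
    (x , suc (countB (x ==Γ_) seen)) ∷ standardizeFrom (x ∷ seen) xs

  standardize : List (Γ n) → List (Γ~ n)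
  standardize = standardizeFrom []

module _ {n : ℕ} where
  open Ops (_<Γ~_ {n})

  cancS : ℕ → Γ~ n → Γ~ n → Bool
  cancS k ((i , b) , _) ((j , c) , _) =
    not b ∧ c ∧ (toℕ i ≡ᵇ toℕ j) ∧ (letterNum (i , b) ≡ᵇ k)

  -- place k_s in the k̄_t's cell, discard k̄_t, remove the entry of (k,1)
  -- and slide that hole out by jeu de taquin
  actS : Γ~ n → List (Γ~ n) → List (Γ~ n) → Tableau (Γ~ n) → Tableau (Γ~ n)
  actS x pre suf below = slide [] (drop 1 (pre ++ x ∷ suf)) below

  stdBereleIns : Tableau (Γ~ n) → Γ~ n → Tableau (Γ~ n)
  stdBereleIns T x = proj₁ (cancelInsert cancS actS 1 T x)

  stdBereleRun : Tableau (Γ~ n) → List (Γ~ n) → Tableau (Γ~ n) × List Shape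
  stdBereleRun T [] = T , []
  stdBereleRun T (x ∷ xs) with stdBereleRun (stdBereleIns T x) xs
  ... | (P , shs) = P , sh (stdBereleIns T x) ∷ shs

  stdBereleP : List (Γ~ n) → Tableau (Γ~ n)
  stdBereleP w = proj₁ (stdBereleRun [] w)

  stdBereleQ : List (Γ~ n) → List Shape
  stdBereleQ w = sh {Γ~ n} [] ∷ proj₂ (stdBereleRun [] w)

-- Relabelling P: the occurrences of γ, taken from left to right (i.e. by
-- increasing column; they form a horizontal strip), become
-- γ_{c(γ)+1}, γ_{c(γ)+2}, ...

module _ {n : ℕ} where

  colCount : Tableau (Γ n) → Γ n → ℕ → ℕ
  colCount P γ j = sum (map (λ r → countB (γ ==Γ_) (take j r)) P)

  countT : Tableau (Γ n) → Γ n → ℕ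
  countT P γ = sum (map (countB (γ ==Γ_)) P)

  labelRow : Tableau (Γ n) → (Γ n → ℕ) → ℕ → List (Γ n) → List (Γ~ n)
  labelRow P c j [] = []
  labelRow P c j (γ ∷ r) = (γ , suc (c γ + colCount P γ j)) ∷ labelRow P c (suc j) r

  relabel : Tableau (Γ n) → (Γ n → ℕ) → Tableau (Γ~ n)
  relabel P c = map (labelRow P c 0) P

-- Label the entries of each Berele tableau: the copies of a letter γ get the indices c(γ)+1, c(γ)+2, …
-- row by row from the bottom up, where c(γ) counts the γ's cancelled so far. The γ's of a semistandard
-- tableau form a horizontal strip, so this is the left-to-right labelling of the statement.
-- Labelling commutes with every insertion step. Labels never change a comparison of distinct letters; the
-- inserted letter is the latest copy of its kind, so it bumps the same entry; and when jeu de taquin compares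
-- equal letters, the one from the lower row carries the smaller label, as it must. At a cancellation of k
-- and k̄ in row k, Berele insertion erases the new k and the k̄, while standardized insertion erases the
-- first k; its hole slides right past the remaining k's, since everything below row k exceeds k, and from
-- the position of k̄ on it moves exactly like Berele's hole, now with c(k) and c(k̄) one larger.
-- Shapes agree at every step, and counting letters gives the last claim.

module Submission where

open import Defs
open import Level using (0ℓ)
open import Data.Bool using (Bool; true; false; _∧_; if_then_else_)
open import Data.Bool.Properties using (∧-zeroʳ)
open import Data.Empty using (⊥-elim)
open import Data.Unit using (⊤; tt)
open import Data.Fin using (Fin; toℕ)
import Data.Fin as F
open import Data.Fin.Properties using (toℕ-injective)
open import Function using (_∘_)
open import Data.Maybe using (Maybe; just; nothing)
open import Data.Product using (_×_; _,_; proj₁; proj₂)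
open import Data.Nat.ListAction using (sum)
open import Data.Nat.ListAction.Properties using (sum-++)
open import Data.Nat using (ℕ; zero; suc; _+_; _≡ᵇ_; _≤ᵇ_; _≤_; _<_; z≤n; s≤s)
import Data.Nat.Properties as ℕ
open import Algebra.Properties.CommutativeSemigroup ℕ.+-commutativeSemigroup
  using (x∙yz≈y∙xz; x∙yz≈yx∙z; x∙yz≈z∙xy; x∙yz≈xz∙y; xy∙z≈y∙xz)
open import Data.Nat.Tactic.RingSolver using (solve-∀)
open import Data.List using (List; []; _∷_; _++_; length; map; take; drop; head)
open import Data.List.Properties using (++-assoc; ++-identityʳ; take++drop≡id; drop-[]; map-++; map-cong-local)
open import Data.List.Relation.Unary.All as All using (All; []; _∷_)
import Data.List.Relation.Unary.All.Properties as All

open import Data.List.Relation.Unary.AllPairs as AllPairs using (AllPairs; []; _∷_)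
open import Relation.Binary.Bundles using (StrictTotalOrder)
open import Relation.Binary.Definitions using (tri<; tri≈; tri>)
open import Relation.Binary.PropositionalEquality
open import Relation.Nullary using (¬_; _because_; yes; no)
open import Relation.Nullary.Decidable using (dec-true; dec-false)
open import Relation.Nullary.Reflects using (Reflects; invert; fromEquivalence)

record IsStrictWeakOrderᵇ {A : Set} (_<_ : A → A → Bool) : Set where
  field
    <-irrefl : ∀ a → (a < a) ≡ false
    <-trans  : ∀ {a b c} → (a < b) ≡ true → (b < c) ≡ true → (a < c) ≡ true
    ≮-trans  : ∀ {a b c} → (b < a) ≡ false → (c < b) ≡ false → (c < a) ≡ false

module _ {P : Set} {b : Bool} (r : Reflects P b) where
  reflects-true : b ≡ true → P
  reflects-true refl = invert r

  reflects-false : b ≡ false → ¬ P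
  reflects-false refl = invert r

  true-reflects : P → b ≡ true
  true-reflects = dec-true (b because r)

  false-reflects : ¬ P → b ≡ false
  false-reflects = dec-false (b because r)

≡ᵇ-reflects-≡ : ∀ m n → Reflects (m ≡ n) (m ≡ᵇ n)
≡ᵇ-reflects-≡ m n = fromEquivalence (ℕ.≡ᵇ⇒≡ m n) (ℕ.≡⇒≡ᵇ m n)

module _ (S : StrictTotalOrder 0ℓ 0ℓ 0ℓ) where
  open StrictTotalOrder S renaming (Carrier to K; _<_ to _⊏_; trans to ⊏-trans; irrefl to ⊏-irrefl)

  reflected-isStrictWeakOrderᵇ : {A : Set} {_<_ : A → A → Bool} (key : A → K) →
    (∀ x y → Reflects (key x ⊏ key y) (x < y)) → IsStrictWeakOrderᵇ _<_
  reflected-isStrictWeakOrderᵇ key reflects = record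
    { <-irrefl = λ a → false-reflects (reflects a a) (⊏-irrefl Eq.refl)
    ; <-trans  = λ {a b c} p q → true-reflects (reflects a c)
        (⊏-trans (reflects-true (reflects a b) p) (reflects-true (reflects b c) q))
    ; ≮-trans  = λ {a b c} p q → false-reflects (reflects c a)
        (⋢-trans (reflects-false (reflects b a) p) (reflects-false (reflects c b) q))
    }
    where
    ⋢-trans : ∀ {a b c} → ¬ b ⊏ a → ¬ c ⊏ b → ¬ c ⊏ a
    ⋢-trans {a} {b} {c} b⋢a c⋢b c⊏a with compare b a
    ... | tri< b⊏a _ _ = b⋢a b⊏a
    ... | tri≈ _ b≈a _ = c⋢b (proj₁ <-resp-≈ (Eq.sym b≈a) c⊏a)
    ... | tri> _ _ a⊏b = c⋢b (⊏-trans c⊏a a⊏b)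

true≢false : true ≢ false
true≢false ()

split-at-drop : ∀ {A : Set} n (r : List A) {b r'} → drop n r ≡ b ∷ r' → r ≡ take n r ++ b ∷ r'
split-at-drop n r eq = sym (trans (cong (take n r ++_) (sym eq)) (take++drop≡id n r))

All-drop-head : ∀ {A : Set} {P : A → Set} n {r : List A} {b r'} → All P r → drop n r ≡ b ∷ r' → P b
All-drop-head zero (px ∷ _) refl = px
All-drop-head (suc n) (_ ∷ pr) e = All-drop-head n pr e

drop≢∷-[] : ∀ {A : Set} n {b : A} {r'} → drop n [] ≢ b ∷ r'
drop≢∷-[] n e with () ← trans (sym (drop-[] n)) e

length-∷ʳ : ∀ {A : Set} (xs : List A) {a} → length (xs ++ a ∷ []) ≡ suc (length xs)
length-∷ʳ [] = refl
length-∷ʳ (x ∷ xs) = cong suc (length-∷ʳ xs)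

drop-suc-[] : ∀ {A : Set} n (r : List A) → drop n r ≡ [] → drop (suc n) r ≡ []
drop-suc-[] zero [] e = refl
drop-suc-[] (suc n) [] e = refl
drop-suc-[] (suc n) (x ∷ r) e = drop-suc-[] n r e

drop-suc-∷ : ∀ {A : Set} n (r : List A) {b r′} → drop n r ≡ b ∷ r′ → drop (suc n) r ≡ r′
drop-suc-∷ zero (x ∷ r) refl = refl
drop-suc-∷ (suc n) (x ∷ r) e = drop-suc-∷ n r e

bit : Bool → ℕ
bit b = if b then 1 else 0

countB-++ : ∀ {A : Set} (p : A → Bool) xs ys → countB p (xs ++ ys) ≡ countB p xs + countB p ys
countB-++ p [] ys = refl
countB-++ p (x ∷ xs) ys = trans (cong (bit (p x) +_) (countB-++ p xs ys)) (sym (ℕ.+-assoc (bit (p x)) _ _))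

countB-insert : ∀ {A : Set} (p : A → Bool) xs {b ys} → countB p (xs ++ b ∷ ys) ≡ bit (p b) + countB p (xs ++ ys)
countB-insert p [] = refl
countB-insert p (x ∷ xs) {b} =
  trans (cong (bit (p x) +_) (countB-insert p xs)) (x∙yz≈y∙xz (bit (p x)) (bit (p b)) _)

All-insert : ∀ {A : Set} {P : A → Set} xs {ys b} → All P (xs ++ ys) → P b → All P (xs ++ b ∷ ys)
All-insert xs al pb with All.++⁻ xs al
... | pxs , pys = All.++⁺ pxs (pb ∷ pys)

All-delete : ∀ {A : Set} {P : A → Set} xs {ys b} → All P (xs ++ b ∷ ys) → P b × All P (xs ++ ys)
All-delete xs al with All.++⁻ xs al
... | pxs , (pb ∷ pys) = pb , All.++⁺ pxs pys

module Insertion {A : Set} (_<_ : A → A → Bool) where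
  open Ops _<_ renaming (_≤_ to _≼?_)

  _≺_ : A → A → Set
  a ≺ b = (a < b) ≡ true

  _≼_ : A → A → Set
  a ≼ b = (b < a) ≡ false

  ≼?-true : ∀ {a b} → (a ≼? b) ≡ true → a ≼ b
  ≼?-true {a} {b} e with b < a
  ... | false = refl

  ≼?-false : ∀ {a b} → (a ≼? b) ≡ false → b ≺ a
  ≼?-false {a} {b} e with b < a
  ... | true = refl

  bump-nothing : ∀ x r → bump x r ≡ nothing → All (_≼ x) r
  bump-nothing x [] e = []
  bump-nothing x (y ∷ ys) e with x < y in x<y
  bump-nothing x (y ∷ ys) () | true
  ... | false with bump x ys in e′
  ...   | nothing = x<y ∷ bump-nothing x ys e′

  bump-just : ∀ x r {p y s} → bump x r ≡ just (p , y , s) → r ≡ p ++ y ∷ s × All (_≼ x) p × x ≺ y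
  bump-just x [] ()
  bump-just x (y ∷ ys) e with x < y in x<y
  bump-just x (y ∷ ys) refl | true = refl , [] , x<y
  ... | false with bump x ys in e′
  bump-just x (y ∷ ys) refl | false | just (p , z , s) with bump-just x ys e′
  ... | refl , p≼x , x≺z = refl , x<y ∷ p≼x , x≺z


  countTab : (A → Bool) → Tableau A → ℕ
  countTab p T = sum (map (countB p) T)

  slide-count : ∀ p (bef aft : List A) below →
    countTab p (slide bef aft below) ≡ countB p (bef ++ aft) + countTab p below
  slide∷-count : ∀ p (bef aft : List A) r rs →
    countTab p (slide bef aft (r ∷ rs)) ≡ countB p (bef ++ aft) + countTab p (r ∷ rs)
  slideB-count : ∀ p (bef aft : List A) r rs d → drop (length bef) r ≡ d →
    countTab p (slideB bef aft (r ∷ rs) r rs d) ≡ countB p (bef ++ aft) + countTab p (r ∷ rs)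

  private
    countB-shift : ∀ p bef {a : A} aft X →
      countB p ((bef ++ a ∷ []) ++ aft) + X ≡ countB p (bef ++ a ∷ aft) + X
    countB-shift p bef aft X = cong (λ z → countB p z + X) (++-assoc bef _ aft)

    countB-close : ∀ p (bef : List A) X → countB p bef + X ≡ countB p (bef ++ []) + X
    countB-close p bef X = cong (λ z → countB p z + X) (sym (++-identityʳ bef))

    moveUp-count : ∀ p (bef aft r : List A) rs {b r′} → drop (length bef) r ≡ b ∷ r′ →
      countTab p ((bef ++ b ∷ aft) ∷ slide (take (length bef) r) r′ rs) ≡ countB p (bef ++ aft) + countTab p (r ∷ rs)
    moveUp-count p bef aft r rs {b} {r′} e = begin
      countB p (bef ++ b ∷ aft) + countTab p (slide t r′ rs)
        ≡⟨ cong₂ _+_ (countB-insert p bef) (slide-count p t r′ rs) ⟩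
      bit (p b) + countB p (bef ++ aft) + (countB p (t ++ r′) + countTab p rs)
        ≡⟨ reorder (bit (p b)) (countB p (bef ++ aft)) _ _ ⟩
      countB p (bef ++ aft) + (bit (p b) + countB p (t ++ r′) + countTab p rs)
        ≡⟨ cong (λ z → countB p (bef ++ aft) + (z + countTab p rs))
             (trans (sym (countB-insert p t)) (cong (countB p) (sym (split-at-drop (length bef) r e)))) ⟩
      countB p (bef ++ aft) + countTab p (r ∷ rs) ∎
      where
      open ≡-Reasoning
      t : List A
      t = take (length bef) r
      reorder : ∀ a b c d → a + b + (c + d) ≡ b + (a + c + d)
      reorder = solve-∀

  slide-count p [] [] [] = refl
  slide-count p (c ∷ bef) [] [] = countB-close p (c ∷ bef) 0
  slide-count p bef (a ∷ aft) [] = trans (slide-count p (bef ++ a ∷ []) aft []) (countB-shift p bef aft 0)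
  slide-count p bef aft (r ∷ rs) = slide∷-count p bef aft r rs

  slide∷-count p bef [] r rs = slideB-count p bef [] r rs _ refl
  slide∷-count p bef (a ∷ aft) r rs = slideB-count p bef (a ∷ aft) r rs _ refl

  slideB-count p [] [] r rs [] refl = refl
  slideB-count p (c ∷ bef) [] r rs [] e = countB-close p (c ∷ bef) _
  slideB-count p bef (a ∷ aft) r rs [] e =
    trans (slide∷-count p (bef ++ a ∷ []) aft r rs) (countB-shift p bef aft _)
  slideB-count p bef [] r rs (b ∷ r′) e = moveUp-count p bef [] r rs e
  slideB-count p bef (a ∷ aft) r rs (b ∷ r′) e with b ≼? a
  ... | true  = moveUp-count p bef (a ∷ aft) r rs e
  ... | false = trans (slide∷-count p (bef ++ a ∷ []) aft r rs) (countB-shift p bef aft _)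

  module _ (P : ℕ → A → Set) (mono : ∀ {k a} → P (suc k) a → P k a) where
    RowCond : ℕ → Tableau A → Set
    RowCond k [] = ⊤
    RowCond k (r ∷ rs) = All (P k) r × RowCond (suc k) rs

    rowCond-mono : ∀ k T → RowCond (suc k) T → RowCond k T
    rowCond-mono k [] _ = tt
    rowCond-mono k (r ∷ rs) (pr , prs) = All.map mono pr , rowCond-mono (suc k) rs prs

    rowCond⇒All : ∀ k T → RowCond k T → All (All (P k)) T
    rowCond⇒All k [] _ = []
    rowCond⇒All k (r ∷ rs) (pr , prs) = pr ∷ All.map (All.map mono) (rowCond⇒All (suc k) rs prs)

    slide-rowCond : ∀ k (bef aft : List A) below → All (P k) (bef ++ aft) → RowCond (suc k) below →
      RowCond k (slide bef aft below)
    slide∷-rowCond : ∀ k (bef aft : List A) r rs → All (P k) (bef ++ aft) → RowCond (suc k) (r ∷ rs) →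
      RowCond k (slide bef aft (r ∷ rs))
    slideB-rowCond : ∀ k (bef aft : List A) r rs d → drop (length bef) r ≡ d → All (P k) (bef ++ aft) →
      RowCond (suc k) (r ∷ rs) → RowCond k (slideB bef aft (r ∷ rs) r rs d)

    private
      All-shift : ∀ {k} bef {a} aft → All (P k) (bef ++ a ∷ aft) → All (P k) ((bef ++ a ∷ []) ++ aft)
      All-shift bef aft = subst (All _) (sym (++-assoc bef _ aft))

      moveUp-rowCond : ∀ k (bef aft r : List A) rs {b r′} → drop (length bef) r ≡ b ∷ r′ →
        All (P k) (bef ++ aft) → RowCond (suc k) (r ∷ rs) →
        RowCond k ((bef ++ b ∷ aft) ∷ slide (take (length bef) r) r′ rs)
      moveUp-rowCond k bef aft r rs {r′ = r′} e pa (pr , prs)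
        with pb , pr′ ← All-delete (take (length bef) r) (subst (All _) (split-at-drop (length bef) r e) pr)
        = All-insert bef pa (mono pb) , slide-rowCond (suc k) (take (length bef) r) r′ rs pr′ prs

    slide-rowCond k [] [] [] pa prs = tt
    slide-rowCond k (c ∷ bef) [] [] pa prs = All.++⁻ˡ (c ∷ bef) pa , tt
    slide-rowCond k bef (a ∷ aft) [] pa prs = slide-rowCond k (bef ++ a ∷ []) aft [] (All-shift bef aft pa) tt
    slide-rowCond k bef aft (r ∷ rs) = slide∷-rowCond k bef aft r rs

    slide∷-rowCond k bef [] r rs = slideB-rowCond k bef [] r rs _ refl
    slide∷-rowCond k bef (a ∷ aft) r rs = slideB-rowCond k bef (a ∷ aft) r rs _ refl

    slideB-rowCond k [] [] r rs [] refl pa prs = rowCond-mono k (r ∷ rs) prs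
    slideB-rowCond k (c ∷ bef) [] r rs [] e pa prs = All.++⁻ˡ (c ∷ bef) pa , prs
    slideB-rowCond k bef (a ∷ aft) r rs [] e pa prs =
      slide∷-rowCond k (bef ++ a ∷ []) aft r rs (All-shift bef aft pa) prs
    slideB-rowCond k bef [] r rs (b ∷ r′) e = moveUp-rowCond k bef [] r rs e
    slideB-rowCond k bef (a ∷ aft) r rs (b ∷ r′) e pa prs with b ≼? a
    ... | true  = moveUp-rowCond k bef (a ∷ aft) r rs e pa prs
    ... | false = slide∷-rowCond k (bef ++ a ∷ []) aft r rs (All-shift bef aft pa) prs

  firstRow : Tableau A → List A
  firstRow [] = []
  firstRow (r ∷ _) = r

  slide-skip₁ : ∀ (bef : List A) a aft below → All (a ≺_) (firstRow below) →
    slide bef (a ∷ aft) below ≡ slide (bef ++ a ∷ []) aft below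
  slide-skip₁ bef a aft [] _ = refl
  slide-skip₁ bef a aft (r ∷ rs) a≺r with drop (length bef) r in e
  ... | [] = refl
  ... | b ∷ r′ rewrite All-drop-head (length bef) a≺r e = refl

  slide-skip : ∀ ks (bef aft : List A) below → All (λ a → All (a ≺_) (firstRow below)) ks →
    slide bef (ks ++ aft) below ≡ slide (bef ++ ks) aft below
  slide-skip [] bef aft below _ = cong (λ z → slide z aft below) (sym (++-identityʳ bef))
  slide-skip (a ∷ ks) bef aft below (a≺ ∷ ks≺) = begin
    slide bef (a ∷ ks ++ aft) below           ≡⟨ slide-skip₁ bef a (ks ++ aft) below a≺ ⟩
    slide (bef ++ a ∷ []) (ks ++ aft) below   ≡⟨ slide-skip ks (bef ++ a ∷ []) aft below ks≺ ⟩
    slide ((bef ++ a ∷ []) ++ ks) aft below   ≡⟨ cong (λ z → slide z aft below) (++-assoc bef (a ∷ []) ks) ⟩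
    slide (bef ++ a ∷ ks) aft below           ∎
    where open ≡-Reasoning

  module _ (canc : ℕ → A → A → Bool) (act : A → List A → List A → Tableau A → Tableau A)
           (act≗slide : ∀ x p s below → act x p s below ≡ slide p s below) where

    cancelInsert-nothing : ∀ k T x → proj₂ (cancelInsert canc act k T x) ≡ nothing →
      cancelInsert canc act k T x ≡ (rowInsert T x , nothing)
    cancelInsert-nothing k [] x e = refl
    cancelInsert-nothing k (r ∷ rs) x e with bump x r
    ... | nothing = refl
    ... | just (p , z , s) with canc k x z
    ...   | false rewrite cancelInsert-nothing (suc k) rs z e = refl

    module _ (P : ℕ → A → Set) (mono : ∀ {k a} → P (suc k) a → P k a)
             (bumped : ∀ k y z → P k y → P k z → y ≺ z → canc k y z ≡ false → P (suc k) z) where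

      cancelInsert-rowCond : ∀ k T x → RowCond P mono k T → P k x →
        RowCond P mono k (proj₁ (cancelInsert canc act k T x))
      cancelInsert-rowCond k [] x _ px = (px ∷ []) , tt
      cancelInsert-rowCond k (r ∷ rs) x (pr , prs) px with bump x r in e
      ... | nothing = All.++⁺ pr (px ∷ []) , prs
      ... | just (p , z , s) with refl , _ , x≺z ← bump-just x r e
                             with pz , pr′ ← All-delete p pr
                             with canc k x z in c
      ...   | true rewrite act≗slide x p s rs = slide-rowCond P mono k p s rs pr′ prs
      ...   | false = All-insert p pr′ px , cancelInsert-rowCond (suc k) rs z prs (bumped k x z px pz x≺z c)

    -- A cancellation erases the inserted letter x and the bumped letter pair x.
    module _ (p : A → Bool) (pair : A → A) (canc⇒pair : ∀ k x y → canc k x y ≡ true → y ≡ pair x) where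
      removed : Maybe A → ℕ
      removed nothing = 0
      removed (just x) = bit (p x) + bit (p (pair x))

      cancelInsert-count : ∀ k T x →
        countTab p (proj₁ (cancelInsert canc act k T x)) + removed (proj₂ (cancelInsert canc act k T x))
          ≡ countTab p T + bit (p x)
      cancelInsert-count k [] x = reorder (bit (p x))
        where
        reorder : ∀ a → a + 0 + 0 + 0 ≡ a
        reorder = solve-∀
      cancelInsert-count k (r ∷ rs) x with bump x r in e
      ... | nothing rewrite countB-++ p r (x ∷ []) = reorder (countB p r) (bit (p x)) (countTab p rs)
        where
        reorder : ∀ a b c → a + (b + 0) + c + 0 ≡ a + c + b
        reorder = solve-∀
      ... | just (q , z , s) with refl , _ , _ ← bump-just x r e with canc k x z in c
      ...   | true rewrite act≗slide x q s rs | slide-count p q s rs | countB-insert p q {z} {s} | canc⇒pair k x z c =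
        reorder (countB p (q ++ s)) (countTab p rs) (bit (p x)) (bit (p (pair x)))
        where
        reorder : ∀ a b c d → a + b + (c + d) ≡ d + a + b + c
        reorder = solve-∀
      ...   | false rewrite countB-insert p q {x} {s} | countB-insert p q {z} {s} =
        reorder (countB p (q ++ s)) (countTab p (proj₁ (cancelInsert canc act (suc k) rs z))) (countTab p rs)
          (removed (proj₂ (cancelInsert canc act (suc k) rs z))) (bit (p x)) (bit (p z))
          (cancelInsert-count (suc k) rs z)
        where
        reorder : ∀ a t t′ m b c → t + m ≡ t′ + c → b + a + t + m ≡ c + a + t′ + b
        reorder a t t′ m b c h = trans (reassoc b a t m) (trans (cong (b + a +_) h) (commute a t′ b c))
          where
          reassoc : ∀ b a t m → b + a + t + m ≡ b + a + (t + m)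
          reassoc = solve-∀
          commute : ∀ a t′ b c → b + a + (t′ + c) ≡ c + a + t′ + b
          commute = solve-∀

module Semistandardness {A : Set} (_<_ : A → A → Bool) (swo : IsStrictWeakOrderᵇ _<_) where
  open IsStrictWeakOrderᵇ swo
  open Ops _<_ renaming (_≤_ to _≼?_)
  open Insertion _<_ public using (_≺_; _≼_)
  open Insertion _<_ hiding (_≺_; _≼_)

  ≺⇒≼ : ∀ {a b} → a ≺ b → a ≼ b
  ≺⇒≼ {a} {b} a<b with b < a in b<a
  ... | true  = ⊥-elim (true≢false (trans (sym (<-trans a<b b<a)) (<-irrefl a)))
  ... | false = refl

  ≺⇒¬≼ : ∀ {a b} → a ≺ b → ¬ b ≼ a
  ≺⇒¬≼ a<b b≼a = true≢false (trans (sym a<b) b≼a)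

  ≺⇒≢ : ∀ {a b} → a ≺ b → a ≢ b
  ≺⇒≢ {a} a<a refl = true≢false (trans (sym a<a) (<-irrefl a))

  ≼-trans : ∀ {a b c} → a ≼ b → b ≼ c → a ≼ c
  ≼-trans = ≮-trans

  ≼-≺-trans : ∀ {a b c} → a ≼ b → b ≺ c → a ≺ c
  ≼-≺-trans {a} {b} {c} a≼b b≺c with a < c in a<c
  ... | true  = refl
  ... | false = ⊥-elim (≺⇒¬≼ b≺c (≼-trans a<c a≼b))

  ≺-≼-trans : ∀ {a b c} → a ≺ b → b ≼ c → a ≺ c
  ≺-≼-trans {a} {b} {c} a≺b b≼c with a < c in a<c
  ... | true  = refl
  ... | false = ⊥-elim (≺⇒¬≼ a≺b (≼-trans b≼c a<c))

  WeakRow : List A → Set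
  WeakRow = AllPairs _≼_

  data ColStrict : List A → List A → Set where
    []  : ∀ {u} → ColStrict u []
    _∷_ : ∀ {a b u v} → a ≺ b → ColStrict u v → ColStrict (a ∷ u) (b ∷ v)

  ColStrictHd : List A → Tableau A → Set
  ColStrictHd r [] = ⊤
  ColStrictHd r (r′ ∷ _) = ColStrict r r′

  data Semistandard : Tableau A → Set where
    []   : Semistandard []
    cons : ∀ {r rs} → WeakRow r → ColStrictHd r rs → Semistandard rs → Semistandard (r ∷ rs)

  weakRow-++⁻ʳ : ∀ p {q} → WeakRow (p ++ q) → WeakRow q
  weakRow-++⁻ʳ [] w = w
  weakRow-++⁻ʳ (a ∷ p) (_ ∷ w) = weakRow-++⁻ʳ p w

  weakRow-delete : ∀ u {b v} → WeakRow (u ++ b ∷ v) → WeakRow (u ++ v)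
  weakRow-delete [] (_ ∷ w) = w
  weakRow-delete (a ∷ u) (a≼ ∷ w) with All.++⁻ u a≼
  ... | a≼u , (_ ∷ a≼v) = All.++⁺ a≼u a≼v ∷ weakRow-delete u w

  weakRow-insert : ∀ p {q b} → WeakRow (p ++ q) → All (_≼ b) p → All (b ≼_) q → WeakRow (p ++ b ∷ q)
  weakRow-insert [] w [] b≼q = b≼q ∷ w
  weakRow-insert (a ∷ p) (a≼ ∷ w) (a≼b ∷ p≼b) b≼q =
    All.++⁺ (All.++⁻ˡ p a≼) (a≼b ∷ All.++⁻ʳ p a≼) ∷ weakRow-insert p w p≼b b≼q

  weakRow-∷ʳ : ∀ r {b} → WeakRow r → All (_≼ b) r → WeakRow (r ++ b ∷ [])
  weakRow-∷ʳ r w r≼b = weakRow-insert r (subst WeakRow (sym (++-identityʳ r)) w) r≼b []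

  weakRow-replace : ∀ p {s x y} → WeakRow (p ++ y ∷ s) → All (_≼ x) p → x ≺ y → WeakRow (p ++ x ∷ s)
  weakRow-replace [] (y≼s ∷ w) [] x≺y = All.map (≼-trans (≺⇒≼ x≺y)) y≼s ∷ w
  weakRow-replace (a ∷ p) (a≼ ∷ w) (a≼x ∷ p≼x) x≺y with All.++⁻ p a≼
  ... | a≼p , (_ ∷ a≼s) = All.++⁺ a≼p (a≼x ∷ a≼s) ∷ weakRow-replace p w p≼x x≺y

  colStrict-lowerᵘ : ∀ p {s x y v} → ColStrict (p ++ y ∷ s) v → x ≼ y → ColStrict (p ++ x ∷ s) v
  colStrict-lowerᵘ [] [] x≼y = []
  colStrict-lowerᵘ [] (y≺ ∷ cs) x≼y = ≼-≺-trans x≼y y≺ ∷ cs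
  colStrict-lowerᵘ (a ∷ p) [] x≼y = []
  colStrict-lowerᵘ (a ∷ p) (a≺ ∷ cs) x≼y = a≺ ∷ colStrict-lowerᵘ p cs x≼y

  colStrict-++ᵘ : ∀ {u v} w → ColStrict u v → ColStrict (u ++ w) v
  colStrict-++ᵘ w [] = []
  colStrict-++ᵘ w (a≺ ∷ cs) = a≺ ∷ colStrict-++ᵘ w cs

  colStrict-beyond : ∀ {b a aft v} → b ≼ a → ColStrict (a ∷ aft) v → WeakRow v → All (b ≺_) v
  colStrict-beyond b≼a [] _ = []
  colStrict-beyond {b} b≼a (_∷_ {b = c} a≺c _) (c≼ ∷ _) = b≺c ∷ All.map (≺-≼-trans b≺c) c≼
    where
    b≺c : b ≺ c
    b≺c = ≼-≺-trans b≼a a≺c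

  colStrict-trans : ∀ {u v w} → ColStrict u v → ColStrict v w → ColStrict u w
  colStrict-trans _ [] = []
  colStrict-trans (a≺b ∷ cs) (b≺c ∷ cs′) = <-trans a≺b b≺c ∷ colStrict-trans cs cs′

  -- Row insertion: x bumps y out of the upper row, and y bumps z out of (or is appended to) the lower row.
  colStrict-bump : ∀ p {s x y} p′ {z s′} → All (_≼ x) p → x ≺ y → All (_≼ y) p′ →
    ColStrict (p ++ y ∷ s) (p′ ++ z ∷ s′) → ColStrict (p ++ x ∷ s) (p′ ++ y ∷ s′)
  colStrict-bump [] [] _ x≺y _ (_ ∷ cs) = x≺y ∷ cs
  colStrict-bump [] (b ∷ p′) _ _ (b≼y ∷ _) (y≺b ∷ _) = ⊥-elim (≺⇒¬≼ y≺b b≼y)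
  colStrict-bump (a ∷ p) (b ∷ p′) (_ ∷ p≼x) x≺y (_ ∷ p′≼y) (a≺b ∷ cs) =
    a≺b ∷ colStrict-bump p p′ p≼x x≺y p′≼y cs
  colStrict-bump (a ∷ p) [] (a≼x ∷ _) x≺y _ (_ ∷ cs) = ≼-≺-trans a≼x x≺y ∷ colStrict-lowerᵘ p cs (≺⇒≼ x≺y)

  colStrict-bump-∷ʳ : ∀ p {s x y} r → All (_≼ x) p → x ≺ y → All (_≼ y) r →
    ColStrict (p ++ y ∷ s) r → ColStrict (p ++ x ∷ s) (r ++ y ∷ [])
  colStrict-bump-∷ʳ [] [] _ x≺y _ _ = x≺y ∷ []
  colStrict-bump-∷ʳ [] (b ∷ r) _ _ (b≼y ∷ _) (y≺b ∷ _) = ⊥-elim (≺⇒¬≼ y≺b b≼y)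
  colStrict-bump-∷ʳ (a ∷ p) (b ∷ r) (_ ∷ p≼x) x≺y (_ ∷ r≼y) (a≺b ∷ cs) =
    a≺b ∷ colStrict-bump-∷ʳ p r p≼x x≺y r≼y cs
  colStrict-bump-∷ʳ (a ∷ p) [] (a≼x ∷ _) x≺y _ _ = ≼-≺-trans a≼x x≺y ∷ []

  -- A row with a hole is split as bef, aft around it. HoleAbove bef aft r: the holed row lies column-strictly
  -- above r except at the hole. HoleBelow u bef aft mb: u lies column-strictly above the holed row, and its
  -- entry over the hole is below mb, the entry that will move into the hole from below.
  data HoleAbove : List A → List A → List A → Set where
    end  : ∀ {bef aft} → HoleAbove bef aft []
    hole : ∀ {aft b r} → ColStrict aft r → HoleAbove [] aft (b ∷ r)
    _∷_  : ∀ {a b bef aft r} → a ≺ b → HoleAbove bef aft r → HoleAbove (a ∷ bef) aft (b ∷ r)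

  HoleAboveHd : List A → List A → Tableau A → Set
  HoleAboveHd bef aft [] = ⊤
  HoleAboveHd bef aft (r ∷ _) = HoleAbove bef aft r

  belowHole : List A → Tableau A → Maybe A
  belowHole bef [] = nothing
  belowHole bef (r ∷ _) = head (drop (length bef) r)

  data HoleBelow : List A → List A → List A → Maybe A → Set where
    hole : ∀ {c u aft mb} → (∀ {b} → mb ≡ just b → c ≺ b) → ColStrict u aft → HoleBelow (c ∷ u) [] aft mb
    _∷_  : ∀ {c u a bef aft mb} → c ≺ a → HoleBelow u bef aft mb → HoleBelow (c ∷ u) (a ∷ bef) aft mb

  holeAbove-short : ∀ {bef aft r} → HoleAbove bef aft r → drop (length bef) r ≡ [] → ColStrict bef r
  holeAbove-short end e = []
  holeAbove-short (a≺ ∷ h) e = a≺ ∷ holeAbove-short h e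

  holeAbove-shift-short : ∀ {bef aft r a aft′} → HoleAbove bef aft r → drop (length bef) r ≡ [] →
    HoleAbove (bef ++ a ∷ []) aft′ r
  holeAbove-shift-short end e = end
  holeAbove-shift-short (a≺ ∷ h) e = a≺ ∷ holeAbove-shift-short h e

  holeAbove-bef : ∀ {bef aft r b r′} → HoleAbove bef aft r → drop (length bef) r ≡ b ∷ r′ → WeakRow r →
    All (_≺ b) bef
  holeAbove-bef {bef} end e w = ⊥-elim (drop≢∷-[] (length bef) e)
  holeAbove-bef (hole _) e w = []
  holeAbove-bef {_ ∷ bef} (a≺ ∷ h) e (d≼ ∷ w) = ≺-≼-trans a≺ (All-drop-head (length bef) d≼ e) ∷ holeAbove-bef h e w

  holeAbove-aft : ∀ {bef aft r b r′} → HoleAbove bef aft r → drop (length bef) r ≡ b ∷ r′ → ColStrict aft r′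
  holeAbove-aft {bef} end e = ⊥-elim (drop≢∷-[] (length bef) e)
  holeAbove-aft (hole cs) refl = cs
  holeAbove-aft (_ ∷ h) e = holeAbove-aft h e

  holeAbove-shift : ∀ {bef a aft r b r′} → HoleAbove bef (a ∷ aft) r → drop (length bef) r ≡ b ∷ r′ → a ≺ b →
    HoleAbove (bef ++ a ∷ []) aft r
  holeAbove-shift {bef} end e a≺b = ⊥-elim (drop≢∷-[] (length bef) e)
  holeAbove-shift (hole []) refl a≺b = a≺b ∷ end
  holeAbove-shift (hole (_ ∷ cs)) refl a≺b = a≺b ∷ hole cs
  holeAbove-shift (a≺ ∷ h) e a≺b = a≺ ∷ holeAbove-shift h e a≺b

  colStrict⇒holeAbove : ∀ u {b v w} → ColStrict (u ++ b ∷ v) w → HoleAbove u v w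
  colStrict⇒holeAbove [] [] = end
  colStrict⇒holeAbove [] (_ ∷ cs) = hole cs
  colStrict⇒holeAbove (a ∷ u) [] = end
  colStrict⇒holeAbove (a ∷ u) (a≺ ∷ cs) = a≺ ∷ colStrict⇒holeAbove u cs

  colStrictHd⇒holeAboveHd : ∀ u {b v} rs → ColStrictHd (u ++ b ∷ v) rs → HoleAboveHd u v rs
  colStrictHd⇒holeAboveHd u [] _ = tt
  colStrictHd⇒holeAboveHd u (_ ∷ _) cs = colStrict⇒holeAbove u cs

  colStrict-at : ∀ bef {m aft w c} → ColStrict (bef ++ m ∷ aft) w → head (drop (length bef) w) ≡ just c → m ≺ c
  colStrict-at [] (m≺ ∷ _) refl = m≺
  colStrict-at (a ∷ bef) (_ ∷ cs) e = colStrict-at bef cs e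

  colStrict⇒holeBelow : ∀ bef {u m aft mb} → ColStrict u (bef ++ m ∷ aft) → (∀ {c} → mb ≡ just c → m ≺ c) →
    HoleBelow u bef aft mb
  colStrict⇒holeBelow [] (c≺m ∷ cs) m≺ = hole (λ e → <-trans c≺m (m≺ e)) cs
  colStrict⇒holeBelow (a ∷ bef) (c≺ ∷ cs) m≺ = c≺ ∷ colStrict⇒holeBelow bef cs m≺

  holeBelow-bef : ∀ {u bef aft mb} → HoleBelow u bef aft mb → ColStrict u bef
  holeBelow-bef (hole _ _) = []
  holeBelow-bef (c≺ ∷ h) = c≺ ∷ holeBelow-bef h

  holeBelow-fill : ∀ {u bef aft b} → HoleBelow u bef aft (just b) → ColStrict u (bef ++ b ∷ aft)
  holeBelow-fill (hole c≺ cs) = c≺ refl ∷ cs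
  holeBelow-fill (c≺ ∷ h) = c≺ ∷ holeBelow-fill h

  holeBelow-shift : ∀ {u bef a aft mb mb′} → WeakRow u → HoleBelow u bef (a ∷ aft) mb →
    (∀ {c} → mb′ ≡ just c → a ≺ c) → HoleBelow u (bef ++ a ∷ []) aft mb′
  holeBelow-shift ((c≼d ∷ _) ∷ _) (hole _ (d≺a ∷ cs)) a≺ = ≼-≺-trans c≼d d≺a ∷ hole (λ e → <-trans d≺a (a≺ e)) cs
  holeBelow-shift (_ ∷ w) (c≺ ∷ h) a≺ = c≺ ∷ holeBelow-shift w h a≺

  -- After the entry b below the hole moves up, the hole sits in the lower row r at the same column.
  holeBelow-moveUp : ∀ (bef : List A) {aft r b r′} r₂ → HoleAbove bef aft r → drop (length bef) r ≡ b ∷ r′ →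
    ColStrict r r₂ → HoleBelow (bef ++ b ∷ aft) (take (length bef) r) r′ (head (drop (length (take (length bef) r)) r₂))
  holeBelow-moveUp [] [] (hole cs) refl [] = hole (λ ()) cs
  holeBelow-moveUp [] (c ∷ r₂) (hole cs) refl (b≺c ∷ _) = hole (λ { refl → b≺c }) cs
  holeBelow-moveUp (a ∷ bef) {r = _ ∷ r} [] (a≺ ∷ h) e [] =
    a≺ ∷ subst (HoleBelow _ _ _) (cong head (drop-[] (length (take (length bef) r)))) (holeBelow-moveUp bef [] h e [])
  holeBelow-moveUp (a ∷ bef) (c ∷ r₂) (a≺ ∷ h) e (_ ∷ cs) = a≺ ∷ holeBelow-moveUp bef r₂ h e cs

  holeBelow-moveUpHd : ∀ (bef : List A) {aft r b r′} rs → HoleAbove bef aft r → drop (length bef) r ≡ b ∷ r′ →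
    ColStrictHd r rs → HoleBelow (bef ++ b ∷ aft) (take (length bef) r) r′ (belowHole (take (length bef) r) rs)
  holeBelow-moveUpHd bef {r = r} [] h e _ =
    subst (HoleBelow _ _ _) (cong head (drop-[] (length (take (length bef) r)))) (holeBelow-moveUp bef [] h e [])
  holeBelow-moveUpHd bef (r₂ ∷ _) h e cs = holeBelow-moveUp bef r₂ h e cs

  weakRow-vacate : ∀ (bef r : List A) {b r′} → WeakRow r → drop (length bef) r ≡ b ∷ r′ →
    WeakRow (take (length bef) r ++ r′)
  weakRow-vacate bef r w e = weakRow-delete (take (length bef) r) (subst WeakRow (split-at-drop (length bef) r e) w)

  holeAboveHd-vacate : ∀ (bef r : List A) rs {b r′} → ColStrictHd r rs → drop (length bef) r ≡ b ∷ r′ →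
    HoleAboveHd (take (length bef) r) r′ rs
  holeAboveHd-vacate bef r rs cs e =
    colStrictHd⇒holeAboveHd (take (length bef) r) rs (subst (λ z → ColStrictHd z rs) (split-at-drop (length bef) r e) cs)

  -- The second component lets the row above the holed one be checked after the slide.
  SlideSemistandard : List A → List A → Tableau A → Set
  SlideSemistandard bef aft below =
    Semistandard (slide bef aft below) ×
    (∀ u → WeakRow u → HoleBelow u bef aft (belowHole bef below) → ColStrictHd u (slide bef aft below))

  private
    weakRow-reassoc : ∀ bef {a : A} aft → WeakRow (bef ++ a ∷ aft) → WeakRow ((bef ++ a ∷ []) ++ aft)
    weakRow-reassoc bef aft = subst WeakRow (sym (++-assoc bef _ aft))

    moveUp : ∀ (bef aft r : List A) rs {b r′} → WeakRow (bef ++ aft) → WeakRow r → ColStrictHd r rs →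
      HoleAbove bef aft r → drop (length bef) r ≡ b ∷ r′ → All (b ≼_) aft →
      SlideSemistandard (take (length bef) r) r′ rs →
      Semistandard ((bef ++ b ∷ aft) ∷ slide (take (length bef) r) r′ rs) ×
      (∀ u → WeakRow u → HoleBelow u bef aft (just b) → ColStrict u (bef ++ b ∷ aft))
    moveUp bef aft r rs {b} w wr cs h e b≼aft (ss , below-ok) =
      cons row (below-ok _ row (holeBelow-moveUpHd bef rs h e cs)) ss , λ _ _ → holeBelow-fill
      where
      row : WeakRow (bef ++ b ∷ aft)
      row = weakRow-insert bef w (All.map ≺⇒≼ (holeAbove-bef h e wr)) b≼aft

  slide-semistandard : ∀ (bef aft : List A) below → WeakRow (bef ++ aft) → Semistandard below →
    HoleAboveHd bef aft below → SlideSemistandard bef aft below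
  slide∷-semistandard : ∀ (bef aft : List A) r rs → WeakRow (bef ++ aft) → Semistandard (r ∷ rs) →
    HoleAbove bef aft r → SlideSemistandard bef aft (r ∷ rs)
  slideB-semistandard : ∀ (bef aft : List A) r rs d → drop (length bef) r ≡ d →
    WeakRow (bef ++ aft) → Semistandard (r ∷ rs) → HoleAbove bef aft r →
    Semistandard (slideB bef aft (r ∷ rs) r rs d) ×
    (∀ u → WeakRow u → HoleBelow u bef aft (head d) → ColStrictHd u (slideB bef aft (r ∷ rs) r rs d))

  slide-semistandard [] [] [] w ss h = [] , λ _ _ _ → tt
  slide-semistandard (c ∷ bef) [] [] w ss h =
    cons (subst WeakRow (++-identityʳ _) w) tt [] , λ _ _ → holeBelow-bef
  slide-semistandard bef (a ∷ aft) [] w ss h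
    with ss′ , ok ← slide-semistandard (bef ++ a ∷ []) aft [] (weakRow-reassoc bef aft w) [] tt
    = ss′ , λ u wu hb → ok u wu (holeBelow-shift wu hb (λ ()))
  slide-semistandard bef aft (r ∷ rs) = slide∷-semistandard bef aft r rs

  slide∷-semistandard bef [] r rs = slideB-semistandard bef [] r rs _ refl
  slide∷-semistandard bef (a ∷ aft) r rs = slideB-semistandard bef (a ∷ aft) r rs _ refl

  slideB-semistandard [] [] r rs [] refl w ss h = ss , λ _ _ _ → []
  slideB-semistandard (c ∷ bef) [] r rs [] e w ss h =
    cons (subst WeakRow (++-identityʳ _) w) (holeAbove-short h e) ss , λ _ _ → holeBelow-bef
  slideB-semistandard bef (a ∷ aft) r rs [] e w ss h
    with ss′ , ok ← slide∷-semistandard (bef ++ a ∷ []) aft r rs (weakRow-reassoc bef aft w) ss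
                      (holeAbove-shift-short h e)
    = ss′ , λ u wu hb → ok u wu (holeBelow-shift wu hb nothing-below)
    where
    nothing-below : ∀ {c} → head (drop (length (bef ++ a ∷ [])) r) ≡ just c → a ≺ c
    nothing-below rewrite length-∷ʳ bef {a} | drop-suc-[] (length bef) r e = λ ()
  slideB-semistandard bef [] r rs (b ∷ r′) e w (cons wr cs ss) h =
    moveUp bef [] r rs w wr cs h e []
      (slide-semistandard (take (length bef) r) r′ rs (weakRow-vacate bef r wr e) ss (holeAboveHd-vacate bef r rs cs e))
  slideB-semistandard bef (a ∷ aft) r rs (b ∷ r′) e w ss@(cons wr cs ss′) h with b ≼? a in b≼?a
  ... | true =
    moveUp bef (a ∷ aft) r rs w wr cs h e (b≼a ∷ All.map (≼-trans b≼a) (AllPairs.head (weakRow-++⁻ʳ bef w)))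
      (slide-semistandard (take (length bef) r) r′ rs (weakRow-vacate bef r wr e) ss′ (holeAboveHd-vacate bef r rs cs e))
    where
    b≼a : b ≼ a
    b≼a = ≼?-true b≼?a
  ... | false
    with ss″ , ok ← slide∷-semistandard (bef ++ a ∷ []) aft r rs (weakRow-reassoc bef aft w) ss
                      (holeAbove-shift h e (≼?-false b≼?a))
    = ss″ , λ u wu hb → ok u wu (holeBelow-shift wu hb a≺next)
    where
    a≺next : ∀ {c} → head (drop (length (bef ++ a ∷ [])) r) ≡ just c → a ≺ c
    a≺next rewrite length-∷ʳ bef {a} | drop-suc-∷ (length bef) r e = colStrict-at [] (holeAbove-aft h e)

  module _ (canc : ℕ → A → A → Bool) (act : A → List A → List A → Tableau A → Tableau A)
           (act≗slide : ∀ x p s below → act x p s below ≡ slide p s below) where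

    private
      colStrictHd-++ᵘ : ∀ {r} w rs → ColStrictHd r rs → ColStrictHd (r ++ w) rs
      colStrictHd-++ᵘ w [] _ = tt
      colStrictHd-++ᵘ w (_ ∷ _) cs = colStrict-++ᵘ w cs

      holeBelow-erased : ∀ {u p y z s} rs → ColStrict u (p ++ y ∷ s) → y ≺ z → ColStrictHd (p ++ z ∷ s) rs →
        HoleBelow u p s (belowHole p rs)
      holeBelow-erased {p = p} [] cs _ _ = colStrict⇒holeBelow p cs (λ ())
      holeBelow-erased {p = p} (_ ∷ _) cs y≺z cs′ = colStrict⇒holeBelow p cs (λ e → <-trans y≺z (colStrict-at p cs′ e))

    BumpCompatible : ℕ → Tableau A → A → Set
    BumpCompatible k T x = ∀ p s {x′} → WeakRow (p ++ x ∷ s) → All (_≼ x′) p → x′ ≺ x →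
      ColStrictHd (p ++ x ∷ s) T → ColStrictHd (p ++ x′ ∷ s) (proj₁ (cancelInsert canc act k T x))

    cancelInsert-semistandard : ∀ k T x → Semistandard T →
      Semistandard (proj₁ (cancelInsert canc act k T x)) × BumpCompatible k T x
    cancelInsert-semistandard k [] x _ =
      cons ([] ∷ []) tt [] , λ p s _ p≼x′ x′≺x _ → colStrict-bump-∷ʳ p [] p≼x′ x′≺x [] []
    cancelInsert-semistandard k (r ∷ rs) x (cons wr cs ss) with bump x r in e
    ... | nothing =
      cons (weakRow-∷ʳ r wr (bump-nothing x r e)) (colStrictHd-++ᵘ _ rs cs) ss ,
      λ p s _ p≼x′ x′≺x cs′ → colStrict-bump-∷ʳ p r p≼x′ x′≺x (bump-nothing x r e) cs′
    ... | just (q , z , t) with refl , q≼x , x≺z ← bump-just x r e with canc k x z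
    ...   | true rewrite act≗slide x q t rs
      with ss′ , ok ← slide-semistandard q t rs (weakRow-delete q wr) ss (colStrictHd⇒holeAboveHd q rs cs)
      = ss′ , λ p s w p≼x′ x′≺x cs′ →
          ok _ (weakRow-replace p w p≼x′ x′≺x) (holeBelow-erased rs (colStrict-bump p q p≼x′ x′≺x q≼x cs′) x≺z cs)
    ...   | false with ss′ , compatible ← cancelInsert-semistandard (suc k) rs z ss
      = cons (weakRow-replace q wr q≼x x≺z) (compatible q t wr q≼x x≺z cs) ss′ ,
        λ p s _ p≼x′ x′≺x cs′ → colStrict-bump p q p≼x′ x′≺x q≼x cs′

module Alphabet (n : ℕ) where
  G : Set
  G = Γ n

  module OΓ = Ops (_<Γ_ {n})
  module IΓ = Insertion (_<Γ_ {n})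

  bar : G → G
  bar (i , _) = (i , true)

  bit≤1 : ∀ b → bit b ≤ 1
  bit≤1 true = s≤s z≤n
  bit≤1 false = z≤n

  code-< : ∀ {i j : Fin n} b c → toℕ i < toℕ j → code (i , b) < code (j , c)
  code-< {i} {j} b c i<j = begin-strict
    toℕ i + toℕ i + bit b  ≤⟨ ℕ.+-monoʳ-≤ (toℕ i + toℕ i) (bit≤1 b) ⟩
    toℕ i + toℕ i + 1      ≡⟨ ℕ.+-assoc (toℕ i) (toℕ i) 1 ⟩
    toℕ i + (toℕ i + 1)    ≡⟨ cong (toℕ i +_) (ℕ.+-comm (toℕ i) 1) ⟩
    toℕ i + suc (toℕ i)    <⟨ ℕ.+-mono-<-≤ i<j i<j ⟩
    toℕ j + toℕ j          ≤⟨ ℕ.m≤m+n (toℕ j + toℕ j) (bit c) ⟩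
    toℕ j + toℕ j + bit c  ∎
    where open ℕ.≤-Reasoning

  code-injective : ∀ (x y : G) → code x ≡ code y → x ≡ y
  code-injective (i , b) (j , c) e with ℕ.<-cmp (toℕ i) (toℕ j)
  ... | tri< i<j _ _ = ⊥-elim (ℕ.<-irrefl e (code-< b c i<j))
  ... | tri> _ _ j<i = ⊥-elim (ℕ.<-irrefl (sym e) (code-< c b j<i))
  ... | tri≈ _ i≡j _ with refl ← toℕ-injective i≡j = cong (i ,_) (bit-injective b c (ℕ.+-cancelˡ-≡ _ _ _ e))
    where
    bit-injective : ∀ b c → bit b ≡ bit c → b ≡ c
    bit-injective false false _ = refl
    bit-injective true true _ = refl

  Γ-isStrictWeakOrderᵇ : IsStrictWeakOrderᵇ (_<Γ_ {n})
  Γ-isStrictWeakOrderᵇ = reflected-isStrictWeakOrderᵇ ℕ.<-strictTotalOrder code (λ x y → ℕ.<ᵇ-reflects-< (code x) (code y))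

  module SΓ = Semistandardness (_<Γ_ {n}) Γ-isStrictWeakOrderᵇ

  ==Γ⇒≡ : ∀ {x y : G} → (x ==Γ y) ≡ true → x ≡ y
  ==Γ⇒≡ {x} {y} e = code-injective x y (reflects-true (≡ᵇ-reflects-≡ (code x) (code y)) e)

  ==Γ-refl : ∀ (x : G) → (x ==Γ x) ≡ true
  ==Γ-refl x = true-reflects (≡ᵇ-reflects-≡ (code x) (code x)) refl

  ≢⇒==Γ-false : ∀ {x y : G} → x ≢ y → (x ==Γ y) ≡ false
  ≢⇒==Γ-false {x} {y} x≢y = false-reflects (≡ᵇ-reflects-≡ (code x) (code y)) (x≢y ∘ code-injective x y)

  <Γ⇒code< : ∀ {x y : G} → (x <Γ y) ≡ true → code x < code y
  <Γ⇒code< {x} {y} = reflects-true (ℕ.<ᵇ-reflects-< (code x) (code y))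

  code<⇒<Γ : ∀ {x y : G} → code x < code y → (x <Γ y) ≡ true
  code<⇒<Γ {x} {y} = true-reflects (ℕ.<ᵇ-reflects-< (code x) (code y))

  num<⇒<Γ : ∀ {x y : G} → letterNum x < letterNum y → (x <Γ y) ≡ true
  num<⇒<Γ {i , b} {j , c} (s≤s i<j) = code<⇒<Γ {i , b} {j , c} (code-< b c i<j)

  <Γ⇒num≤ : ∀ {x y : G} → (x <Γ y) ≡ true → letterNum x ≤ letterNum y
  <Γ⇒num≤ {i , b} {j , c} x<y = ℕ.≮⇒≥ (λ { (s≤s j<i) → ℕ.<-asym (<Γ⇒code< {i , b} {j , c} x<y) (code-< c b j<i) })

  unbarred<Γbar : ∀ (x : G) → proj₂ x ≡ false → (x <Γ bar x) ≡ true
  unbarred<Γbar (i , false) refl = code<⇒<Γ {i , false} {i , true} (ℕ.+-monoʳ-< (toℕ i + toℕ i) (s≤s z≤n))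

  <Γ-sameNum : ∀ {x y : G} → letterNum x ≡ letterNum y → (x <Γ y) ≡ true → proj₂ x ≡ false × y ≡ bar x
  <Γ-sameNum {i , b} {j , c} e x<y with refl ← toℕ-injective (ℕ.suc-injective e) = same b c (<Γ⇒code< {i , b} {i , c} x<y)
    where
    same : ∀ b c → code (i , b) < code (i , c) → b ≡ false × (i , c) ≡ (i , true)
    same false true  _  = refl , refl
    same false false lt = ⊥-elim (ℕ.<-irrefl refl lt)
    same true  c     lt = ⊥-elim (ℕ.<-irrefl refl (ℕ.<-≤-trans lt (ℕ.+-monoʳ-≤ (toℕ i + toℕ i) (bit≤1 c))))

  private
    ∧-true⁻ : ∀ {a b} → (a ∧ b) ≡ true → a ≡ true × b ≡ true
    ∧-true⁻ {true} {true} _ = refl , refl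

  cancB-true : ∀ k (x y : G) → cancB k x y ≡ true → proj₂ x ≡ false × y ≡ bar x × letterNum x ≡ k
  cancB-true k (i , false) (j , true) e with i≡j , num≡k ← ∧-true⁻ {toℕ i ≡ᵇ toℕ j} e =
    refl , cong (_, true) (sym (toℕ-injective (reflects-true (≡ᵇ-reflects-≡ _ _) i≡j))) ,
    reflects-true (≡ᵇ-reflects-≡ _ _) num≡k

  -- A record rather than a synonym, so that k and a can be inferred from Admissible k a.
  record Admissible (k : ℕ) (a : G) : Set where
    constructor admissible
    field k≤num : k ≤ letterNum a

  admissible-mono : ∀ {k a} → Admissible (suc k) a → Admissible k a
  admissible-mono (admissible k<num) = admissible (ℕ.<⇒≤ k<num)

  bumped-admissible : ∀ k (y z : G) → Admissible k y → Admissible k z → (y <Γ z) ≡ true → cancB k y z ≡ false →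
    Admissible (suc k) z
  bumped-admissible k y z (admissible k≤y) (admissible k≤z) y<z no-canc with letterNum z ℕ.≟ k
  ... | no z≢k = admissible (ℕ.≤∧≢⇒< k≤z (z≢k ∘ sym))
  ... | yes refl with refl , refl ← <Γ-sameNum (ℕ.≤-antisym (<Γ⇒num≤ y<z) k≤y) y<z
    = ⊥-elim (true≢false (trans (sym canc) no-canc))
    where
    canc : cancB k y z ≡ true
    canc rewrite true-reflects (≡ᵇ-reflects-≡ (toℕ (proj₁ y)) (toℕ (proj₁ y))) refl = refl

  private
    rowAdmissible : ℕ → List G → Bool
    rowAdmissible k = allB (λ x → k ≤ᵇ letterNum x)

    allB-false : ∀ (f : G → Bool) l {z} m → f z ≡ false → allB f (l ++ z ∷ m) ≡ false
    allB-false f [] m e rewrite e = refl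
    allB-false f (a ∷ l) m e rewrite allB-false f l m e = ∧-zeroʳ (f a)

    rowCond-rowInsert : ∀ k (rs : Tableau G) z → (k ≤ᵇ letterNum z) ≡ false → rowCond k (OΓ.rowInsert rs z) ≡ false
    rowCond-rowInsert k [] z e rewrite e = refl
    rowCond-rowInsert k (r ∷ rs) z e with OΓ.bump z r
    ... | nothing = cong (_∧ rowCond (suc k) rs) (allB-false (λ x → k ≤ᵇ letterNum x) r [] e)
    ... | just (p , y , s) = cong (_∧ rowCond (suc k) (OΓ.rowInsert rs y)) (allB-false (λ x → k ≤ᵇ letterNum x) p s e)

  -- A cancellation in row k means that plain row insertion would put k̄ into row k + 1.
  cancellation⇒¬rowCond : ∀ k (T : Tableau G) x {x′} → proj₂ (OΓ.cancelInsert cancB actB k T x) ≡ just x′ →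
    rowCond k (OΓ.rowInsert T x) ≡ false
  cancellation⇒¬rowCond k (r ∷ rs) x e with OΓ.bump x r
  ... | just (p , z , s) with cancB k x z in c
  ...   | true with _ , refl , refl ← cancB-true k x z c =
    trans (cong (rowAdmissible k (p ++ x ∷ s) ∧_) (rowCond-rowInsert (suc k) rs (bar x) k̄∉row[k+1])) (∧-zeroʳ _)
    where
    k̄∉row[k+1] : (suc (letterNum x) ≤ᵇ letterNum (bar x)) ≡ false
    k̄∉row[k+1] = false-reflects (ℕ.≤ᵇ-reflects-≤ (suc (letterNum x)) (letterNum x)) (ℕ.n≮n (letterNum x))
  ...   | false = trans (cong (rowAdmissible k (p ++ x ∷ s) ∧_) (cancellation⇒¬rowCond (suc k) rs z e)) (∧-zeroʳ _)

  bereleIns≡cancelInsert : ∀ (T : Tableau G) x → bereleIns T x ≡ OΓ.cancelInsert cancB actB 1 T x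
  bereleIns≡cancelInsert T x with isSp (OΓ.rowInsert T x) in sp
  ... | false = refl
  ... | true with proj₂ (OΓ.cancelInsert cancB actB 1 T x) in e
  ...   | nothing = sym (IΓ.cancelInsert-nothing cancB actB (λ _ _ _ _ → refl) 1 T x e)
  ...   | just _ = ⊥-elim (true≢false (trans (sym sp)
                     (trans (cong (OΓ.semistandard (OΓ.rowInsert T x) ∧_) (cancellation⇒¬rowCond 1 T x e)) (∧-zeroʳ _))))

  row-≼-unbarred : ∀ {k} (x e : G) → proj₂ x ≡ false → letterNum x ≡ k → Admissible k e → (x <Γ e) ≡ false → e ≡ x
  row-≼-unbarred (i , false) (j , c) refl refl (admissible k≤e) x≮e with letterNum (j , c) ℕ.≟ letterNum (i , false)
  ... | no e≢x = ⊥-elim (true≢false (trans (sym (num<⇒<Γ {i , false} {j , c} (ℕ.≤∧≢⇒< k≤e (e≢x ∘ sym)))) x≮e))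
  ... | yes e≡x with refl ← toℕ-injective (ℕ.suc-injective e≡x) with c
  ...   | false = refl
  ...   | true = ⊥-elim (true≢false (trans (sym (unbarred<Γbar (i , false) refl)) x≮e))

  below-row : ∀ {k} (x e : G) → letterNum x ≡ k → Admissible (suc k) e → (x <Γ e) ≡ true
  below-row x e refl (admissible x<e) = num<⇒<Γ {x} {e} x<e

  below-row-≢ : ∀ {k} (x e : G) → letterNum x ≡ k → Admissible (suc k) e → e ≢ x × e ≢ bar x
  below-row-≢ x e refl (admissible x<e) = (λ { refl → ℕ.n≮n _ x<e }) , (λ { refl → ℕ.n≮n _ x<e })

module Labelling (n : ℕ) where
  open Alphabet n

  G~ : Set
  G~ = Γ~ n

  module OΓ~ = Ops (_<Γ~_ {n})
  module IΓ~ = Insertion (_<Γ~_ {n})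

  δ : G → G → ℕ
  δ x γ = bit (γ ==Γ x)

  _⊕_ : (G → ℕ) → G → (G → ℕ)
  (d ⊕ x) γ = δ x γ + d γ

  label : (G → ℕ) → List G → List G~
  label d [] = []
  label d (x ∷ l) = (x , suc (d x)) ∷ label (d ⊕ x) l

  advance : (G → ℕ) → List G → (G → ℕ)
  advance d [] = d
  advance d (x ∷ l) = advance (d ⊕ x) l

  offset : (G → ℕ) → Tableau G → (G → ℕ)
  offset c T γ = c γ + countT T γ

  -- Labels are handed out row by row from the bottom up, after the c γ letters γ already cancelled.
  labelTab : (G → ℕ) → Tableau G → Tableau G~
  labelTab c [] = []
  labelTab c (r ∷ rs) = label (offset c rs) r ∷ labelTab c rs

  δ-self : ∀ x → δ x x ≡ 1
  δ-self x rewrite ==Γ-refl x = refl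

  δ-≢ : ∀ {γ x} → γ ≢ x → δ x γ ≡ 0
  δ-≢ γ≢x rewrite ≢⇒==Γ-false γ≢x = refl

  mult-∉ : ∀ l {b} → All (_≢ b) l → mult l b ≡ 0
  mult-∉ [] [] = refl
  mult-∉ (x ∷ l) (x≢b ∷ l≢b) rewrite ≢⇒==Γ-false (x≢b ∘ sym) = mult-∉ l l≢b

  advance-apply : ∀ d l γ → advance d l γ ≡ d γ + mult l γ
  advance-apply d [] γ = sym (ℕ.+-identityʳ (d γ))
  advance-apply d (x ∷ l) γ = trans (advance-apply (d ⊕ x) l γ) (xy∙z≈y∙xz (δ x γ) (d γ) (mult l γ))

  label-++ : ∀ d p q → label d (p ++ q) ≡ label d p ++ label (advance d p) q
  label-++ d [] q = refl
  label-++ d (x ∷ p) q = cong ((x , suc (d x)) ∷_) (label-++ (d ⊕ x) p q)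

  advance-++ : ∀ d p q → advance d (p ++ q) ≡ advance (advance d p) q
  advance-++ d [] q = refl
  advance-++ d (x ∷ p) q = advance-++ (d ⊕ x) p q

  length-label : ∀ d l → length (label d l) ≡ length l
  length-label d [] = refl
  length-label d (x ∷ l) = cong suc (length-label (d ⊕ x) l)

  label-cong : ∀ l {d d′} → All (λ γ → d γ ≡ d′ γ) l → label d l ≡ label d′ l
  label-cong [] _ = refl
  label-cong (x ∷ l) (e ∷ es) = cong₂ _∷_ (cong (λ m → x , suc m) e) (label-cong l (All.map (λ {γ} → cong (δ x γ +_)) es))

  take-label : ∀ k d l → take k (label d l) ≡ label d (take k l)
  take-label zero d l = refl
  take-label (suc k) d [] = refl
  take-label (suc k) d (x ∷ l) = cong ((x , suc (d x)) ∷_) (take-label k (d ⊕ x) l)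

  drop-label : ∀ k d l → drop k (label d l) ≡ label (advance d (take k l)) (drop k l)
  drop-label zero d l = refl
  drop-label (suc k) d [] = refl
  drop-label (suc k) d (x ∷ l) = drop-label k (d ⊕ x) l

  sh-labelTab : ∀ c T → sh (labelTab c T) ≡ sh T
  sh-labelTab c [] = refl
  sh-labelTab c (r ∷ rs) = cong₂ _∷_ (length-label _ r) (sh-labelTab c rs)

  labelTab-cong : ∀ (Q : G → Set) T {c c′} → All (All Q) T → (∀ γ → Q γ → c γ ≡ c′ γ) → labelTab c T ≡ labelTab c′ T
  labelTab-cong Q [] _ _ = refl
  labelTab-cong Q (r ∷ rs) (qr ∷ qrs) c≗c′ =
    cong₂ _∷_ (label-cong r (All.map (λ {γ} q → cong (_+ countT rs γ) (c≗c′ γ q)) qr)) (labelTab-cong Q rs qrs c≗c′)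

  labelTab-cong′ : ∀ T {c c′} → (∀ γ → c γ ≡ c′ γ) → labelTab c T ≡ labelTab c′ T
  labelTab-cong′ T c≗c′ = labelTab-cong (λ _ → ⊤) T (All.universal (λ _ → All.universal (λ _ → tt) _) T) (λ γ _ → c≗c′ γ)

  <Γ~-label : ∀ (x z : G) s t → ((x ==Γ z) ≡ true → t ≤ s) → ((x , s) <Γ~ (z , t)) ≡ (x <Γ z)
  <Γ~-label x z s t t≤s with x <Γ z
  ... | true = refl
  ... | false with x ==Γ z
  ...   | false = refl
  ...   | true = false-reflects (ℕ.<ᵇ-reflects-< s t) (ℕ.≤⇒≯ (t≤s refl))

  labelBump : (G → ℕ) → Maybe (List G × G × List G) → Maybe (List G~ × G~ × List G~)
  labelBump d nothing = nothing
  labelBump d (just (p , y , q)) = just (label d p , (y , suc (advance d p y)) , label (advance d p ⊕ y) q)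

  private
    exceeds-head : ∀ (d : G → ℕ) r {x z : G} {s} → d x + mult (z ∷ r) x < s → (x ==Γ z) ≡ true → suc (d z) ≤ s
    exceeds-head d r {x} {z} fresh e with refl ← ==Γ⇒≡ {x} {z} e = ℕ.≤-trans (s≤s (ℕ.m≤m+n (d x) (mult (z ∷ r) x))) fresh

  -- x_s exceeds every labelled x of the row, so it bumps the same entry as x does.
  bump-label : ∀ d r x s → d x + mult r x < s → OΓ~.bump (x , s) (label d r) ≡ labelBump d (OΓ.bump x r)
  bump-label d [] x s _ = refl
  bump-label d (z ∷ r) x s fresh rewrite <Γ~-label x z s (suc (d z)) (exceeds-head d r {x} {z} fresh) with x <Γ z
  ... | true = refl
  ... | false rewrite bump-label (d ⊕ z) r x s (subst (_< s) (x∙yz≈yx∙z (d x) (δ z x) (mult r x)) fresh) with OΓ.bump x r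
  ...   | nothing = refl
  ...   | just _ = refl

  label-splice : ∀ bef b aft {D E E′ m} → All (λ γ → E γ ≡ D γ) bef → m ≡ advance D bef b →
    All (λ γ → E′ γ ≡ (advance D bef ⊕ b) γ) aft →
    label E bef ++ (b , suc m) ∷ label E′ aft ≡ label D (bef ++ b ∷ aft)
  label-splice bef b aft {D} E≗D refl E′≗D′ =
    trans (cong₂ (λ X Y → X ++ (b , suc (advance D bef b)) ∷ Y) (label-cong bef E≗D) (label-cong aft E′≗D′))
          (sym (label-++ D bef (b ∷ aft)))

  private
    open SΓ using (WeakRow; Semistandard; cons; HoleAbove; HoleAboveHd; ColStrict; []; _∷_; _≼_;
                   holeAbove-bef; holeAbove-aft; holeAbove-shift; holeAbove-shift-short; weakRow-vacate;
                   holeAboveHd-vacate; weakRow-++⁻ʳ; colStrict-beyond; ≺⇒≢)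
    open IΓ using (≼?-true; ≼?-false)

    label-shift : ∀ E bef a aft B →
      OΓ~.slide (label E bef ++ (a , suc (advance E bef a)) ∷ []) (label (advance E bef ⊕ a) aft) B
        ≡ OΓ~.slide (label E (bef ++ a ∷ [])) (label (advance E (bef ++ a ∷ [])) aft) B
    label-shift E bef a aft B =
      cong₂ (λ X Y → OΓ~.slide X (label Y aft) B) (sym (label-++ E bef (a ∷ []))) (sym (advance-++ E bef (a ∷ [])))

    drop-label-under : ∀ E F (bef r : List G) →
      drop (length (label E bef)) (label F r) ≡ label (advance F (take (length bef) r)) (drop (length bef) r)
    drop-label-under E F bef r = trans (cong (λ k → drop k (label F r)) (length-label E bef)) (drop-label (length bef) F r)

    moveUp-offset : ∀ c (bef r : List G) rs {b r′} → drop (length bef) r ≡ b ∷ r′ →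
      ∀ γ → δ b γ + offset c (OΓ.slide (take (length bef) r) r′ rs) γ ≡ offset c (r ∷ rs) γ
    moveUp-offset c bef r rs {b} {r′} e γ = begin
      δ b γ + (c γ + countT (OΓ.slide t r′ rs) γ)
        ≡⟨ cong (λ z → δ b γ + (c γ + z)) (IΓ.slide-count (γ ==Γ_) t r′ rs) ⟩
      δ b γ + (c γ + (mult (t ++ r′) γ + countT rs γ))
        ≡⟨ cong (λ z → δ b γ + (c γ + (z + countT rs γ))) (countB-++ (γ ==Γ_) t r′) ⟩
      δ b γ + (c γ + (mult t γ + mult r′ γ + countT rs γ))
        ≡⟨ reorder (δ b γ) (c γ) (mult t γ) (mult r′ γ) (countT rs γ) ⟩
      c γ + (mult t γ + (δ b γ + mult r′ γ) + countT rs γ)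
        ≡˘⟨ cong (λ z → c γ + (z + countT rs γ)) (countB-++ (γ ==Γ_) t (b ∷ r′)) ⟩
      c γ + (mult (t ++ b ∷ r′) γ + countT rs γ)
        ≡˘⟨ cong (λ z → c γ + (mult z γ + countT rs γ)) (split-at-drop (length bef) r e) ⟩
      c γ + (mult r γ + countT rs γ)                       ∎
      where
      open ≡-Reasoning
      t : List G
      t = take (length bef) r
      reorder : ∀ x c t r′ rs → x + (c + (t + r′ + rs)) ≡ c + (t + (x + r′) + rs)
      reorder = solve-∀

    moveUp-label : ∀ c (bef aft r : List G) rs {b r′} → drop (length bef) r ≡ b ∷ r′ →
      All (_≢ b) bef → All (_≢ b) r′ →
      let t = take (length bef) r ; E = offset c (r ∷ rs) ; F = offset c rs in
      OΓ~.slide (label F t) (label (advance F t) r′) (labelTab c rs) ≡ labelTab c (OΓ.slide t r′ rs) →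
      (label E bef ++ (b , suc (advance F t b)) ∷ label (advance E bef) aft) ∷
        OΓ~.slide (take (length (label E bef)) (label F r)) (label (advance F t ⊕ b) r′) (labelTab c rs)
        ≡ labelTab c ((bef ++ b ∷ aft) ∷ OΓ.slide t r′ rs)
    moveUp-label c bef aft r rs {b} {r′} e bef≢b r′≢b below-ok = cong₂ _∷_ top-row lower-rows
      where
      t : List G
      t = take (length bef) r
      S : Tableau G
      S = OΓ.slide t r′ rs
      E : G → ℕ
      E = offset c (r ∷ rs)
      F : G → ℕ
      F = offset c rs
      D : G → ℕ
      D = offset c S
      label-b : advance F t b ≡ advance D bef b
      label-b = begin
        advance F t b
          ≡⟨ advance-apply F t b ⟩
        c b + countT rs b + mult t b
          ≡⟨ reorder (c b) (countT rs b) (mult t b) ⟩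
        c b + (mult t b + 0 + countT rs b) + 0
          ≡˘⟨ cong₂ (λ x y → c b + (mult t b + x + countT rs b) + y) (mult-∉ r′ r′≢b) (mult-∉ bef bef≢b) ⟩
        c b + (mult t b + mult r′ b + countT rs b) + mult bef b
          ≡˘⟨ cong (λ z → c b + (z + countT rs b) + mult bef b) (countB-++ (b ==Γ_) t r′) ⟩
        c b + (mult (t ++ r′) b + countT rs b) + mult bef b
          ≡˘⟨ cong (λ z → c b + z + mult bef b) (IΓ.slide-count (b ==Γ_) t r′ rs) ⟩
        D b + mult bef b
          ≡˘⟨ advance-apply D bef b ⟩
        advance D bef b                                  ∎
        where
        open ≡-Reasoning
        reorder : ∀ c rs t → c + rs + t ≡ c + (t + 0 + rs) + 0
        reorder = solve-∀
      top-row : label E bef ++ (b , suc (advance F t b)) ∷ label (advance E bef) aft ≡ label D (bef ++ b ∷ aft)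
      top-row = label-splice bef b aft
        (All.map (λ {γ} γ≢b → trans (sym (moveUp-offset c bef r rs e γ)) (cong (_+ D γ) (δ-≢ γ≢b))) bef≢b) label-b
        (All.universal (λ γ → trans (advance-apply E bef γ) (trans (cong (_+ mult bef γ) (sym (moveUp-offset c bef r rs e γ)))
          (trans (ℕ.+-assoc (δ b γ) _ _) (cong (δ b γ +_) (sym (advance-apply D bef γ)))))) aft)
      lower-rows : OΓ~.slide (take (length (label E bef)) (label F r)) (label (advance F t ⊕ b) r′) (labelTab c rs)
                     ≡ labelTab c S
      lower-rows = trans (cong₂ (λ X Y → OΓ~.slide X Y (labelTab c rs))
        (trans (cong (λ k → take k (label F r)) (length-label E bef)) (take-label (length bef) F r))
        (label-cong r′ (All.map (λ {γ} γ≢b → cong (_+ advance F t γ) (δ-≢ γ≢b)) r′≢b))) below-ok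

    -- Entries of a lower row carry smaller labels than equal entries of the rows above.
    lower-label-smaller : ∀ c (bef : List G) r rs {a b r′} → drop (length bef) r ≡ b ∷ r′ → (a ==Γ b) ≡ true →
      suc (advance (offset c rs) (take (length bef) r) b) ≤ suc (advance (offset c (r ∷ rs)) bef a)
    lower-label-smaller c bef r rs {a} {b} {r′} e a=b with refl ← ==Γ⇒≡ {a} {b} a=b = s≤s (begin
      advance F t a
        ≡⟨ advance-apply F t a ⟩
      c a + countT rs a + mult t a
        ≤⟨ ℕ.m≤m+n _ (suc (mult r′ a) + mult bef a) ⟩
      c a + countT rs a + mult t a + (suc (mult r′ a) + mult bef a)
        ≡⟨ reorder (c a) (countT rs a) (mult t a) (mult r′ a) (mult bef a) ⟩
      c a + (suc (mult t a + mult r′ a) + countT rs a) + mult bef a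
        ≡˘⟨ cong (λ z → c a + (z + countT rs a) + mult bef a) mult-r ⟩
      c a + (mult r a + countT rs a) + mult bef a
        ≡˘⟨ advance-apply (offset c (r ∷ rs)) bef a ⟩
      advance (offset c (r ∷ rs)) bef a                           ∎)
      where
      open ℕ.≤-Reasoning
      t : List G
      t = take (length bef) r
      F : G → ℕ
      F = offset c rs
      mult-r : mult r a ≡ suc (mult t a + mult r′ a)
      mult-r = trans (cong (λ z → mult z a) (split-at-drop (length bef) r e))
        (trans (countB-insert (a ==Γ_) t) (cong₂ _+_ (cong bit (==Γ-refl a)) (countB-++ (a ==Γ_) t r′)))
      reorder : ∀ c rs t r′ bef → c + rs + t + (suc r′ + bef) ≡ c + (suc (t + r′) + rs) + bef
      reorder = solve-∀

  SlideLabelled : (G → ℕ) → List G → List G → Tableau G → Set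
  SlideLabelled c bef aft below =
    OΓ~.slide (label (offset c below) bef) (label (advance (offset c below) bef) aft) (labelTab c below)
      ≡ labelTab c (OΓ.slide bef aft below)

  slide-label : ∀ c (bef aft : List G) below → WeakRow (bef ++ aft) → Semistandard below →
    HoleAboveHd bef aft below → SlideLabelled c bef aft below
  slide∷-label : ∀ c (bef aft : List G) r rs → WeakRow (bef ++ aft) → Semistandard (r ∷ rs) →
    HoleAbove bef aft r → SlideLabelled c bef aft (r ∷ rs)
  slideB-label : ∀ c (bef aft : List G) r rs d → drop (length bef) r ≡ d →
    WeakRow (bef ++ aft) → Semistandard (r ∷ rs) → HoleAbove bef aft r →
    let E = offset c (r ∷ rs) ; F = offset c rs in
    OΓ~.slideB (label E bef) (label (advance E bef) aft) (labelTab c (r ∷ rs)) (label F r) (labelTab c rs)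
      (label (advance F (take (length bef) r)) d) ≡ labelTab c (OΓ.slideB bef aft (r ∷ rs) r rs d)

  slide-label c [] [] [] w ss h = refl
  slide-label c (x ∷ bef) [] [] w ss h = refl
  slide-label c bef (a ∷ aft) [] w ss h =
    trans (label-shift (offset c []) bef a aft [])
      (slide-label c (bef ++ a ∷ []) aft [] (subst WeakRow (sym (++-assoc bef _ aft)) w) [] tt)
  slide-label c bef aft (r ∷ rs) = slide∷-label c bef aft r rs

  slide∷-label c bef [] r rs w ss h =
    trans (cong (OΓ~.slideB _ [] _ _ _) (drop-label-under (offset c (r ∷ rs)) (offset c rs) bef r))
      (slideB-label c bef [] r rs _ refl w ss h)
  slide∷-label c bef (a ∷ aft) r rs w ss h =
    trans (cong (OΓ~.slideB _ (label (advance (offset c (r ∷ rs)) bef) (a ∷ aft)) _ _ _)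
                (drop-label-under (offset c (r ∷ rs)) (offset c rs) bef r))
      (slideB-label c bef (a ∷ aft) r rs _ refl w ss h)

  slideB-label c [] [] r rs [] refl w ss h = refl
  slideB-label c (x ∷ bef) [] r rs [] e w ss h = refl
  slideB-label c bef (a ∷ aft) r rs [] e w ss h =
    trans (label-shift (offset c (r ∷ rs)) bef a aft (labelTab c (r ∷ rs)))
      (slide∷-label c (bef ++ a ∷ []) aft r rs (subst WeakRow (sym (++-assoc bef _ aft)) w) ss (holeAbove-shift-short h e))
  slideB-label c bef [] r rs (b ∷ r′) e w (cons wr cs ss) h =
    moveUp-label c bef [] r rs e (All.map ≺⇒≢ (holeAbove-bef h e wr)) (nothing-right (holeAbove-aft h e))
      (slide-label c (take (length bef) r) r′ rs (weakRow-vacate bef r wr e) ss (holeAboveHd-vacate bef r rs cs e))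
    where
    nothing-right : ∀ {v} → ColStrict [] v → All (_≢ b) v
    nothing-right [] = []
  slideB-label c bef (a ∷ aft) r rs (b ∷ r′) e w ss@(cons wr cs ss′) h
    rewrite <Γ~-label a b (suc (advance (offset c (r ∷ rs)) bef a)) (suc (advance (offset c rs) (take (length bef) r) b))
              (lower-label-smaller c bef r rs e)
    with OΓ._≤_ b a in b≤a
  ... | false =
    trans (label-shift (offset c (r ∷ rs)) bef a aft (labelTab c (r ∷ rs)))
      (slide∷-label c (bef ++ a ∷ []) aft r rs (subst WeakRow (sym (++-assoc bef _ aft)) w) ss
        (holeAbove-shift h e (≼?-false {b} {a} b≤a)))
  ... | true =
    moveUp-label c bef (a ∷ aft) r rs e (All.map ≺⇒≢ (holeAbove-bef h e wr))
      (All.map (λ {γ} b≺γ → ≺⇒≢ {b} {γ} b≺γ ∘ sym)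
        (colStrict-beyond {b} {a} (≼?-true {b} {a} b≤a) (holeAbove-aft h e) r′-weak))
      (slide-label c (take (length bef) r) r′ rs (weakRow-vacate bef r wr e) ss′ (holeAboveHd-vacate bef r rs cs e))
    where
    r′-weak : WeakRow r′
    r′-weak with _ ∷ w′ ← weakRow-++⁻ʳ (take (length bef) r) (subst WeakRow (split-at-drop (length bef) r e) wr) = w′

module LabelledInsertion (n : ℕ) where
  open Alphabet n
  open Labelling n

  -- number of letters γ erased by a step whose cancellation (if any) involved the letter k
  cancelled : Maybe G → G → ℕ
  cancelled nothing γ = 0
  cancelled (just k) (i , _) = bit ((i , false) ==Γ k)

  _after_ : (G → ℕ) → Maybe G → (G → ℕ)
  (c after m) γ = cancelled m γ + c γ

  cancelled-pair : ∀ (x γ : G) → proj₂ x ≡ false → δ x γ + δ (bar x) γ ≡ cancelled (just x) γ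
  cancelled-pair (i , false) (j , b) refl with j F.≟ i
  ... | no j≢i rewrite ≢⇒==Γ-false {j , b} {i , false} (j≢i ∘ cong proj₁) | ≢⇒==Γ-false {j , b} {i , true} (j≢i ∘ cong proj₁)
                     | ≢⇒==Γ-false {j , false} {i , false} (j≢i ∘ cong proj₁) = refl
  cancelled-pair (i , false) (i , false) refl | yes refl
    rewrite ==Γ-refl (i , false) | ≢⇒==Γ-false {i , false} {i , true} (λ ()) = refl
  cancelled-pair (i , false) (i , true) refl | yes refl
    rewrite ==Γ-refl (i , false) | ==Γ-refl (i , true) | ≢⇒==Γ-false {i , true} {i , false} (λ ()) = refl

  cancelled-self : ∀ (x : G) → proj₂ x ≡ false → cancelled (just x) x ≡ 1
  cancelled-self (i , false) refl rewrite ==Γ-refl (i , false) = refl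

  cancelled-other : ∀ (x γ : G) → proj₂ x ≡ false → γ ≢ x → cancelled (just x) γ ≡ δ (bar x) γ
  cancelled-other x γ x-unbarred γ≢x = trans (sym (cancelled-pair x γ x-unbarred)) (cong (_+ δ (bar x) γ) (δ-≢ γ≢x))

  cancelled-unbarred : ∀ k (T : Tableau G) x {x′} → proj₂ (OΓ.cancelInsert cancB actB k T x) ≡ just x′ → proj₂ x′ ≡ false
  cancelled-unbarred k (r ∷ rs) x e with OΓ.bump x r
  ... | just (p , z , s) with cancB k x z in c
  cancelled-unbarred k (r ∷ rs) x refl | just (p , z , s) | true = proj₁ (cancB-true k x z c)
  ... | false = cancelled-unbarred (suc k) rs z e

  cancelInsert-countT : ∀ k (T : Tableau G) x γ →
    let (T′ , m) = OΓ.cancelInsert cancB actB k T x in countT T′ γ + cancelled m γ ≡ countT T γ + δ x γ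
  cancelInsert-countT k T x γ with OΓ.cancelInsert cancB actB k T x in e
                                 | IΓ.cancelInsert-count cancB actB (λ _ _ _ _ → refl) (γ ==Γ_) bar
                                     (λ k x y c → proj₁ (proj₂ (cancB-true k x y c))) k T x
  ... | T′ , nothing | count = count
  ... | T′ , just x′ | count =
    trans (cong (countT T′ γ +_) (sym (cancelled-pair x′ γ (cancelled-unbarred k T x (cong proj₂ e))))) count

  offset-after : ∀ c m t rs y → (∀ γ → countT t γ + cancelled m γ ≡ countT rs γ + δ y γ) →
    ∀ γ → offset (c after m) t γ ≡ δ y γ + offset c rs γ
  offset-after c m t rs y count γ = begin
    cancelled m γ + c γ + countT t γ    ≡⟨ reorder (cancelled m γ) (c γ) (countT t γ) ⟩
    c γ + (countT t γ + cancelled m γ)  ≡⟨ cong (c γ +_) (count γ) ⟩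
    c γ + (countT rs γ + δ y γ)         ≡⟨ x∙yz≈z∙xy (c γ) (countT rs γ) (δ y γ) ⟩
    δ y γ + (c γ + countT rs γ)         ∎
    where
    open ≡-Reasoning
    reorder : ∀ h a t → h + a + t ≡ a + (t + h)
    reorder = solve-∀

  private
    open SΓ using (WeakRow; Semistandard; cons; HoleAboveHd; colStrictHd⇒holeAboveHd; weakRow-delete; weakRow-++⁻ʳ;
                   ≺⇒≢; ≼-≺-trans; ≺-≼-trans)
    open IΓ using (_≺_; _≼_; bump-just; RowCond; rowCond⇒All)

    ∷ʳ-replicate : ∀ (x : G) p → All (_≡ x) p → p ++ x ∷ [] ≡ x ∷ p
    ∷ʳ-replicate x [] _ = refl
    ∷ʳ-replicate x (_ ∷ p) (refl ∷ p≡x) = cong (x ∷_) (∷ʳ-replicate x p p≡x)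

    All-label : ∀ d l {P : G → Set} {Q : G~ → Set} → All P l → (∀ {γ m} → P γ → Q (γ , m)) → All Q (label d l)
    All-label d [] [] f = []
    All-label d (x ∷ l) (px ∷ pl) f = f px ∷ All-label (d ⊕ x) l pl f

    <Γ⇒<Γ~ : ∀ {x e : G} {m m′} → (x <Γ e) ≡ true → ((x , m) <Γ~ (e , m′)) ≡ true
    <Γ⇒<Γ~ x<e rewrite x<e = refl

  copies-skippable : ∀ {k} c d (p : List G) x → letterNum x ≡ k → All (_≡ x) p → ∀ rs → All (All (Admissible (suc k))) rs →
    All (λ a → All (a IΓ~.≺_) (IΓ~.firstRow (labelTab c rs))) (label d p)
  copies-skippable c d p x x≡k p≡x [] _ = All-label d p p≡x (λ _ → [])
  copies-skippable c d p x x≡k p≡x (r ∷ _) (r-admissible ∷ _) = All-label d p p≡x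
    (λ { {m = m} refl → All-label _ r r-admissible (λ {e} {m′} e-adm → <Γ⇒<Γ~ {x} {e} {m} {m′} (below-row x e x≡k e-adm)) })

  labelTab-cancel-above : ∀ {k} c x → proj₂ x ≡ false → letterNum x ≡ k → ∀ rs → All (All (Admissible (suc k))) rs →
    labelTab c rs ≡ labelTab (c after just x) rs
  labelTab-cancel-above c x x-unbarred x≡k rs rs-admissible = labelTab-cong _ rs rs-admissible (λ γ γ-adm →
    let γ≢x , γ≢x̄ = below-row-≢ x γ x≡k γ-adm in
    cong (_+ c γ) (sym (trans (cancelled-other x γ x-unbarred γ≢x) (δ-≢ γ≢x̄))))

  -- Standardized insertion erases the leftmost x of row k, Berele insertion the new one; the hole left in
  -- column 1 slides right past the remaining copies of x (everything below exceeds x) to where x̄ was.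
  cancellation-label : ∀ k c (p q : List G) rs (x : G) → proj₂ x ≡ false → letterNum x ≡ k →
    All (_≡ x) p → All (_≢ x) q → All (All (Admissible (suc k))) rs →
    WeakRow (p ++ q) → Semistandard rs → HoleAboveHd p q rs →
    let D = offset c rs in
    OΓ~.slide [] (drop 1 (label D p ++ (x , suc (advance D p x)) ∷ label (advance D p ⊕ bar x) q)) (labelTab c rs)
      ≡ labelTab (c after just x) (OΓ.slide p q rs)
  cancellation-label k c p q rs x x-unbarred x≡k p≡x q≢x rs-admissible w ss h = begin
    OΓ~.slide [] (drop 1 (label D p ++ (x , suc (advance D p x)) ∷ L)) (labelTab c rs)
      ≡⟨ cong (λ z → OΓ~.slide [] (drop 1 z) (labelTab c rs)) rotate ⟩
    OΓ~.slide [] (label (D ⊕ x) p ++ L) (labelTab c rs)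
      ≡⟨ IΓ~.slide-skip (label (D ⊕ x) p) [] L (labelTab c rs) (copies-skippable c (D ⊕ x) p x x≡k p≡x rs rs-admissible) ⟩
    OΓ~.slide (label (D ⊕ x) p) L (labelTab c rs)
      ≡⟨ cong₂ (λ X Y → OΓ~.slide X Y (labelTab c rs)) relabel-p relabel-q ⟩
    OΓ~.slide (label D′ p) (label (advance D′ p) q) (labelTab c rs)
      ≡⟨ cong (OΓ~.slide (label D′ p) (label (advance D′ p) q)) (labelTab-cancel-above c x x-unbarred x≡k rs rs-admissible) ⟩
    OΓ~.slide (label D′ p) (label (advance D′ p) q) (labelTab c′ rs)
      ≡⟨ slide-label c′ p q rs w ss h ⟩
    labelTab c′ (OΓ.slide p q rs) ∎
    where
    open ≡-Reasoning
    D : G → ℕ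
    D = offset c rs
    c′ : G → ℕ
    c′ = c after just x
    D′ : G → ℕ
    D′ = offset c′ rs
    L : List G~
    L = label (advance D p ⊕ bar x) q
    rotate : label D p ++ (x , suc (advance D p x)) ∷ L ≡ (x , suc (D x)) ∷ (label (D ⊕ x) p ++ L)
    rotate = trans (sym (++-assoc (label D p) _ L))
      (cong (_++ L) (trans (sym (label-++ D p (x ∷ []))) (cong (label D) (∷ʳ-replicate x p p≡x))))
    relabel-p : label (D ⊕ x) p ≡ label D′ p
    relabel-p = label-cong p (All.map (λ { refl → trans (cong (_+ D x) (δ-self x))
      (cong (λ z → z + c x + countT rs x) (sym (cancelled-self x x-unbarred))) }) p≡x)
    relabel-q : L ≡ label (advance D′ p) q
    relabel-q = label-cong q (All.map (λ {γ} γ≢x → begin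
      δ (bar x) γ + advance D p γ
        ≡⟨ cong (δ (bar x) γ +_) (advance-apply D p γ) ⟩
      δ (bar x) γ + (c γ + countT rs γ + mult p γ)
        ≡⟨ reassoc (δ (bar x) γ) (c γ) (countT rs γ) (mult p γ) ⟩
      δ (bar x) γ + c γ + countT rs γ + mult p γ
        ≡˘⟨ cong (λ z → z + c γ + countT rs γ + mult p γ) (cancelled-other x γ x-unbarred γ≢x) ⟩
      D′ γ + mult p γ
        ≡˘⟨ advance-apply D′ p γ ⟩
      advance D′ p γ                              ∎) q≢x)
      where
      reassoc : ∀ a b t s → a + (b + t + s) ≡ a + b + t + s
      reassoc = solve-∀

  fresh-label : ∀ c (p q : List G) y rs {x} → x ≢ y → All (_≢ x) q →
    c x + countT ((p ++ y ∷ q) ∷ rs) x ≡ advance (offset c rs) p x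
  fresh-label c p q y rs {x} x≢y q≢x = begin
    c x + (mult (p ++ y ∷ q) x + countT rs x)
      ≡⟨ cong (λ z → c x + (z + countT rs x)) (countB-insert (x ==Γ_) p) ⟩
    c x + (δ y x + mult (p ++ q) x + countT rs x)
      ≡⟨ cong (λ z → c x + (δ y x + z + countT rs x)) (countB-++ (x ==Γ_) p q) ⟩
    c x + (δ y x + (mult p x + mult q x) + countT rs x)
      ≡⟨ cong₂ (λ a b → c x + (a + (mult p x + b) + countT rs x)) (δ-≢ x≢y) (mult-∉ q q≢x) ⟩
    c x + (0 + (mult p x + 0) + countT rs x)
      ≡⟨ reorder (c x) (mult p x) (countT rs x) ⟩
    c x + countT rs x + mult p x
      ≡˘⟨ advance-apply (offset c rs) p x ⟩
    advance (offset c rs) p x                            ∎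
    where
    open ≡-Reasoning
    reorder : ∀ a b t → a + (0 + (b + 0) + t) ≡ a + t + b
    reorder = solve-∀

  -- x replaces y in row p ++ y ∷ q, and y is inserted into the rows rs, producing t with cancellation m.
  replaced-label : ∀ c (p q : List G) (x y : G) rs t m → All (_≢ y) p → x ≢ y → All (_≢ x) q →
    (∀ γ → countT t γ + cancelled m γ ≡ countT rs γ + δ y γ) →
    let D = offset c rs in
    label D p ++ (x , suc (c x + countT ((p ++ y ∷ q) ∷ rs) x)) ∷ label (advance D p ⊕ y) q
      ≡ label (offset (c after m) t) (p ++ x ∷ q)
  replaced-label c p q x y rs t m p≢y x≢y q≢x count = label-splice p x q
    (All.map (λ {γ} γ≢y → trans (cong (_+ D γ) (sym (δ-≢ γ≢y))) (sym (D′≗ γ))) p≢y)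
    label-x
    (All.map (λ {γ} γ≢x → begin
      δ y γ + advance D p γ              ≡⟨ cong (δ y γ +_) (advance-apply D p γ) ⟩
      δ y γ + (D γ + mult p γ)           ≡˘⟨ ℕ.+-assoc (δ y γ) (D γ) (mult p γ) ⟩
      δ y γ + D γ + mult p γ             ≡˘⟨ cong (_+ mult p γ) (D′≗ γ) ⟩
      D′ γ + mult p γ                    ≡˘⟨ advance-apply D′ p γ ⟩
      advance D′ p γ                     ≡˘⟨ cong (_+ advance D′ p γ) (δ-≢ γ≢x) ⟩
      δ x γ + advance D′ p γ             ∎) q≢x)
    where
    open ≡-Reasoning
    D : G → ℕ
    D = offset c rs
    D′ : G → ℕ
    D′ = offset (c after m) t
    D′≗ : ∀ γ → D′ γ ≡ δ y γ + D γ
    D′≗ = offset-after c m t rs y count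
    label-x : c x + countT ((p ++ y ∷ q) ∷ rs) x ≡ advance D′ p x
    label-x = begin
      c x + countT ((p ++ y ∷ q) ∷ rs) x  ≡⟨ fresh-label c p q y rs x≢y q≢x ⟩
      advance D p x                       ≡⟨ advance-apply D p x ⟩
      D x + mult p x                      ≡˘⟨ cong (λ z → z + D x + mult p x) (δ-≢ x≢y) ⟩
      δ y x + D x + mult p x              ≡˘⟨ cong (_+ mult p x) (D′≗ x) ⟩
      D′ x + mult p x                     ≡˘⟨ advance-apply D′ p x ⟩
      advance D′ p x                      ∎

  -- The inserted letter x carries the label c x + countT T x + 1: it is the latest x read so far.
  cancelInsert-label : ∀ k (T : Tableau G) c x → Semistandard T → RowCond Admissible admissible-mono k T → Admissible k x →
    let (T′ , m) = OΓ.cancelInsert cancB actB k T x in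
    proj₁ (OΓ~.cancelInsert cancS actS k (labelTab c T) (x , suc (c x + countT T x))) ≡ labelTab (c after m) T′
  cancelInsert-label k [] c x _ _ _ = refl
  cancelInsert-label k (r ∷ rs) c x (cons wr cs ss) (r-adm , rs-adm) x-adm
    rewrite bump-label (offset c rs) r x (suc (c x + countT (r ∷ rs) x))
              (s≤s (ℕ.≤-reflexive (sym (x∙yz≈xz∙y (c x) (mult r x) (countT rs x)))))
    with OΓ.bump x r in e
  ... | nothing = cong (_∷ labelTab c rs) (trans (cong (λ z → label D r ++ (x , suc z) ∷ []) label-x)
                                                (sym (label-++ D r (x ∷ []))))
    where
    D : G → ℕ
    D = offset c rs
    label-x : c x + countT (r ∷ rs) x ≡ advance D r x
    label-x = trans (x∙yz≈xz∙y (c x) (mult r x) (countT rs x)) (sym (advance-apply D r x))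
  ... | just (p , y , q) with refl , p≼x , x≺y ← bump-just x r e with cancB k x y in canc
  ...   | false =
    cong₂ _∷_ (replaced-label c p q x y rs (proj₁ lower) (proj₂ lower) p≢y (≺⇒≢ {x} {y} x≺y) q≢x
                (cancelInsert-countT (suc k) rs y))
      (trans (cong (λ z → proj₁ (OΓ~.cancelInsert cancS actS (suc k) (labelTab c rs) (y , suc z))) label-y)
             (cancelInsert-label (suc k) rs c y ss rs-adm y-adm))
    where
    D : G → ℕ
    D = offset c rs
    lower : Tableau G × Maybe G
    lower = OΓ.cancelInsert cancB actB (suc k) rs y
    p≢y : All (_≢ y) p
    p≢y = All.map (λ {a} a≼x → ≺⇒≢ {a} {y} (≼-≺-trans {a} {x} {y} a≼x x≺y)) p≼x
    q≢x : All (_≢ x) q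
    q≢x with y≼q ∷ _ ← weakRow-++⁻ʳ p wr = All.map (λ {a} y≼a → ≺⇒≢ {x} {a} (≺-≼-trans {x} {y} {a} x≺y y≼a) ∘ sym) y≼q
    label-y : advance D p y ≡ c y + countT rs y
    label-y = trans (advance-apply D p y) (trans (cong (D y +_) (mult-∉ p p≢y)) (ℕ.+-identityʳ (D y)))
    y-adm : Admissible (suc k) y
    y-adm with y-adm′ , _ ← All-delete p r-adm = bumped-admissible k x y x-adm y-adm′ x≺y canc
  ...   | true with x-unbarred , refl , x≡k ← cancB-true k x y canc =
    trans (cong (λ z → OΓ~.slide [] (drop 1 (label D p ++ (x , suc z) ∷ label (advance D p ⊕ bar x) q)) (labelTab c rs))
                label-x)
      (cancellation-label k c p q rs x x-unbarred x≡k p≡x q≢x (rowCond⇒All Admissible admissible-mono (suc k) rs rs-adm)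
        (weakRow-delete p wr) ss (colStrictHd⇒holeAboveHd p rs cs))
    where
    D : G → ℕ
    D = offset c rs
    p≡x : All (_≡ x) p
    p≡x = All.zipWith (λ (a≼x , a-adm) → row-≼-unbarred x _ x-unbarred x≡k a-adm a≼x) (p≼x , All.++⁻ˡ p r-adm)
    q≢x : All (_≢ x) q
    q≢x with x̄≼q ∷ _ ← weakRow-++⁻ʳ p wr =
      All.map (λ { x̄≼x refl → true≢false (trans (sym (unbarred<Γbar x x-unbarred)) x̄≼x) }) x̄≼q
    label-x : c x + countT ((p ++ bar x ∷ q) ∷ rs) x ≡ advance D p x
    label-x = fresh-label c p q (bar x) rs (λ x≡x̄ → true≢false (trans (sym (cong proj₂ x≡x̄)) x-unbarred)) q≢x

module Relabelling (n : ℕ) where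
  open Alphabet n
  open Labelling n
  open SΓ using (WeakRow; Semistandard; []; cons; ColStrict; ColStrictHd; _∷_; ≺⇒≢; ≺-≼-trans; ≼-≺-trans; colStrict-trans)
  open IΓ using (_≺_; _≼_)

  private
    take-length-++ : ∀ (xs ys : List G) → take (length xs) (xs ++ ys) ≡ xs
    take-length-++ [] ys = refl
    take-length-++ (x ∷ xs) ys = cong (x ∷_) (take-length-++ xs ys)

    sum-map-zero : ∀ (f : List G → ℕ) (T : Tableau G) → All (λ u → f u ≡ 0) T → sum (map f T) ≡ 0
    sum-map-zero f [] [] = refl
    sum-map-zero f (u ∷ T) (fu≡0 ∷ fT≡0) rewrite fu≡0 | sum-map-zero f T fT≡0 = refl

    above-prefix : ∀ (v₁ : List G) {γ v₂ u} → ColStrict u (v₁ ++ γ ∷ v₂) → WeakRow (v₁ ++ γ ∷ v₂) →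
      All (_≺ γ) (take (length v₁) u)
    above-prefix [] cs w = []
    above-prefix (a ∷ v₁) {γ} {u = b ∷ u} (b≺a ∷ cs) (a≼ ∷ w) =
      ≺-≼-trans {b} {a} {γ} b≺a (proj₁ (All-delete v₁ a≼)) ∷ above-prefix v₁ cs w

    colStrict-≻ : ∀ {γ} {v w : List G} → ColStrict v w → All (γ ≼_) v → All (γ ≺_) w
    colStrict-≻ [] _ = []
    colStrict-≻ {γ} (_∷_ {a} {b} a≺b cs) (γ≼a ∷ γ≼v) = ≼-≺-trans {γ} {a} {b} γ≼a a≺b ∷ colStrict-≻ {γ} cs γ≼v

    below-suffix : ∀ (v₁ : List G) {γ v₂ w} → ColStrict (v₁ ++ γ ∷ v₂) w → WeakRow (v₁ ++ γ ∷ v₂) →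
      All (γ ≺_) (drop (length v₁) w)
    below-suffix [] [] _ = []
    below-suffix [] {γ} (γ≺ ∷ cs) (γ≼ ∷ _) = γ≺ ∷ colStrict-≻ {γ} cs γ≼
    below-suffix (a ∷ v₁) [] _ = []
    below-suffix (a ∷ v₁) (_ ∷ cs) (_ ∷ w) = below-suffix v₁ cs w

    semistandard-below : ∀ {v below} → Semistandard (v ∷ below) → All (ColStrict v) below
    semistandard-below {below = []} _ = []
    semistandard-below {below = _ ∷ _} (cons _ cs ss) = cs ∷ All.map (colStrict-trans cs) (semistandard-below ss)

  -- In a semistandard tableau the γ's left of column j + 1 are those of the lower rows and of the row
  -- itself (horizontal strip).
  labelRow-inside : ∀ c (top : Tableau G) v below → All (λ u → ColStrict u v) top → All (ColStrict v) below → WeakRow v →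
    ∀ v₁ v₂ → v ≡ v₁ ++ v₂ → labelRow (top ++ v ∷ below) c (length v₁) v₂ ≡ label (advance (offset c below) v₁) v₂
  labelRow-inside c top v below above below-ok w v₁ [] e = refl
  labelRow-inside c top v below above below-ok w v₁ (γ ∷ v₂) refl = cong₂ _∷_ (cong (λ m → γ , suc m) head-label) (begin
    labelRow P c (suc (length v₁)) v₂
      ≡˘⟨ cong (λ j → labelRow P c j v₂) (length-∷ʳ v₁) ⟩
    labelRow P c (length (v₁ ++ γ ∷ [])) v₂
      ≡⟨ labelRow-inside c top v below above below-ok w (v₁ ++ γ ∷ []) v₂ (sym (++-assoc v₁ _ v₂)) ⟩
    label (advance (offset c below) (v₁ ++ γ ∷ [])) v₂
      ≡⟨ cong (λ d → label d v₂) (advance-++ (offset c below) v₁ (γ ∷ [])) ⟩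
    label (advance (offset c below) v₁ ⊕ γ) v₂    ∎)
    where
    open ≡-Reasoning
    P : Tableau G
    P = top ++ (v₁ ++ γ ∷ v₂) ∷ below
    j : ℕ
    j = length v₁
    f : List G → ℕ
    f r = countB (γ ==Γ_) (take j r)
    none-above : sum (map f top) ≡ 0
    none-above = sum-map-zero f top
      (All.map (λ cs → mult-∉ _ (All.map (λ {e} e≺γ → ≺⇒≢ {e} {γ} e≺γ) (above-prefix v₁ cs w))) above)
    all-left-below : sum (map f below) ≡ countT below γ
    all-left-below = cong sum (map-cong-local (All.map (λ {r} cs → begin
      mult (take j r) γ
        ≡˘⟨ ℕ.+-identityʳ _ ⟩
      mult (take j r) γ + 0                      ≡˘⟨ cong (mult (take j r) γ +_) (mult-∉ (drop j r)
                                                      (All.map (λ {e} γ≺e → ≺⇒≢ {γ} {e} γ≺e ∘ sym) (below-suffix v₁ cs w))) ⟩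
      mult (take j r) γ + mult (drop j r) γ
        ≡˘⟨ countB-++ (γ ==Γ_) (take j r) (drop j r) ⟩
      mult (take j r ++ drop j r) γ
        ≡⟨ cong (λ z → mult z γ) (take++drop≡id j r) ⟩
      mult r γ                                   ∎) below-ok))
    head-label : c γ + colCount P γ j ≡ advance (offset c below) v₁ γ
    head-label = begin
      c γ + sum (map f P)                                      ≡⟨ cong (λ z → c γ + sum z) (map-++ f top _) ⟩
      c γ + sum (map f top ++ map f ((v₁ ++ γ ∷ v₂) ∷ below))  ≡⟨ cong (c γ +_) (sum-++ (map f top) _) ⟩
      c γ + (sum (map f top) + (f (v₁ ++ γ ∷ v₂) + sum (map f below)))
        ≡⟨ cong₂ (λ a b → c γ + (a + (mult b γ + sum (map f below)))) none-above (take-length-++ v₁ _) ⟩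
      c γ + (mult v₁ γ + sum (map f below))                   ≡⟨ cong (λ z → c γ + (mult v₁ γ + z)) all-left-below ⟩
      c γ + (mult v₁ γ + countT below γ)                      ≡⟨ x∙yz≈xz∙y (c γ) (mult v₁ γ) (countT below γ) ⟩
      c γ + countT below γ + mult v₁ γ                        ≡˘⟨ advance-apply (offset c below) v₁ γ ⟩
      advance (offset c below) v₁ γ                           ∎

  private
    AboveFirst : Tableau G → Tableau G → Set
    AboveFirst top [] = ⊤
    AboveFirst top (v ∷ _) = All (λ u → ColStrict u v) top

    relabel-rows : ∀ c (top mid : Tableau G) → Semistandard mid → AboveFirst top mid →
      map (labelRow (top ++ mid) c 0) mid ≡ labelTab c mid
    relabel-rows c top [] _ _ = refl
    relabel-rows c top (v ∷ below) ss@(cons w cs ss′) above =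
      cong₂ _∷_ (labelRow-inside c top v below above (semistandard-below ss) w [] v refl)
        (trans (cong (λ T → map (labelRow T c 0) below) (sym (++-assoc top (v ∷ []) below)))
          (relabel-rows c (top ++ v ∷ []) below ss′ (above-next below cs)))
      where
      above-next : ∀ below → ColStrictHd v below → AboveFirst (top ++ v ∷ []) below
      above-next [] _ = tt
      above-next (_ ∷ _) cs = All.++⁺ (All.map (λ cs′ → colStrict-trans cs′ cs) above) (cs ∷ [])

  labelTab≡relabel : ∀ c (T : Tableau G) → Semistandard T → labelTab c T ≡ relabel T c
  labelTab≡relabel c T ss = sym (relabel-rows c [] T ss (above-nothing T))
    where
    above-nothing : ∀ T → AboveFirst [] T
    above-nothing [] = tt
    above-nothing (_ ∷ _) = []

module Correspondence (n : ℕ) where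
  open Alphabet n
  open Labelling n
  open LabelledInsertion n
  open SΓ using (Semistandard; []; cancelInsert-semistandard)
  open IΓ using (RowCond; cancelInsert-rowCond)

  cancelledBy : List G → G → ℕ
  cancelledBy cs (i , _) = countB (λ k → (i , false) ==Γ k) cs

  record Invariant (T : Tableau G) (c : G → ℕ) (seen : List G) : Set where
    field
      semistandard   : Semistandard T
      rowsAdmissible : RowCond Admissible admissible-mono 1 T
      content        : ∀ γ → countT T γ + c γ ≡ mult seen γ

  stdBereleIns-label : ∀ T c seen x → Invariant T c seen →
    let (T′ , m) = OΓ.cancelInsert cancB actB 1 T x in
    stdBereleIns (labelTab c T) (x , suc (mult seen x)) ≡ labelTab (c after m) T′ × Invariant T′ (c after m) (x ∷ seen)
  stdBereleIns-label T c seen x inv = std-step , record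
    { semistandard   = proj₁ (cancelInsert-semistandard cancB actB (λ _ _ _ _ → refl) 1 T x semistandard)
    ; rowsAdmissible = cancelInsert-rowCond cancB actB (λ _ _ _ _ → refl) Admissible admissible-mono bumped-admissible
                         1 T x rowsAdmissible x-admissible
    ; content        = λ γ → begin
        countT T′ γ + (cancelled m γ + c γ)  ≡˘⟨ ℕ.+-assoc (countT T′ γ) _ _ ⟩
        countT T′ γ + cancelled m γ + c γ    ≡⟨ cong (_+ c γ) (cancelInsert-countT 1 T x γ) ⟩
        countT T γ + δ x γ + c γ             ≡⟨ xy∙z≈y∙xz (countT T γ) (δ x γ) (c γ) ⟩
        δ x γ + (countT T γ + c γ)           ≡⟨ cong (δ x γ +_) (content γ) ⟩
        δ x γ + mult seen γ                  ∎
    }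
    where
    open Invariant inv
    open ≡-Reasoning
    T′ : Tableau G
    T′ = proj₁ (OΓ.cancelInsert cancB actB 1 T x)
    m : Maybe G
    m = proj₂ (OΓ.cancelInsert cancB actB 1 T x)
    x-admissible : Admissible 1 x
    x-admissible = admissible (s≤s z≤n)
    std-step : stdBereleIns (labelTab c T) (x , suc (mult seen x)) ≡ labelTab (c after m) T′
    std-step rewrite sym (content x) | ℕ.+-comm (countT T x) (c x) =
      cancelInsert-label 1 T c x semistandard rowsAdmissible x-admissible

  initial : Invariant [] (λ _ → 0) []
  initial = record { semistandard = [] ; rowsAdmissible = tt ; content = λ _ → refl }

  private
    mult-move : ∀ (x : G) seen xs (γ : G) → mult (x ∷ seen) γ + mult xs γ ≡ mult seen γ + mult (x ∷ xs) γ
    mult-move x seen xs γ = xy∙z≈y∙xz (δ x γ) (mult seen γ) (mult xs γ)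

    cancelled-cons : ∀ k cs (c : G → ℕ) γ → cancelledBy cs γ + (cancelled (just k) γ + c γ) ≡ cancelledBy (k ∷ cs) γ + c γ
    cancelled-cons k cs c γ = x∙yz≈yx∙z (cancelledBy cs γ) (cancelled (just k) γ) (c γ)

  stdBereleRun-label : ∀ xs T c seen → Invariant T c seen →
    let (P , shapes , cs) = bereleRun T xs ; c′ = λ γ → cancelledBy cs γ + c γ in
    stdBereleRun (labelTab c T) (standardizeFrom seen xs) ≡ (labelTab c′ P , shapes) ×
    Semistandard P × (∀ γ → countT P γ + c′ γ ≡ mult seen γ + mult xs γ)
  stdBereleRun-label [] T c seen inv = refl , semistandard , λ γ → trans (content γ) (sym (ℕ.+-identityʳ _))
    where open Invariant inv
  stdBereleRun-label (x ∷ xs) T c seen inv rewrite bereleIns≡cancelInsert T x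
    with OΓ.cancelInsert cancB actB 1 T x | stdBereleIns-label T c seen x inv
  ... | T′ , m | std-step , inv′ rewrite std-step
    with bereleRun T′ xs | stdBereleRun-label xs T′ (c after m) (x ∷ seen) inv′
  ... | P , shapes , cs | std-run , ss , count rewrite std-run with m
  ...   | nothing =
    cong (labelTab (λ γ → cancelledBy cs γ + c γ) P ,_) (cong (_∷ shapes) (sh-labelTab c T′)) , ss ,
    λ γ → trans (count γ) (mult-move x seen xs γ)
  ...   | just k =
    cong₂ _,_ (labelTab-cong′ P (cancelled-cons k cs c)) (cong (_∷ shapes) (sh-labelTab (c after just k) T′)) , ss ,
    λ γ → trans (cong (countT P γ +_) (sym (cancelled-cons k cs c γ))) (trans (count γ) (mult-move x seen xs γ))

lemma2p7 : (n : ℕ) → 1 ≤ n → (w : List (Γ n)) →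
    (stdBereleQ (standardize w) ≡ bereleQ w)
    × (stdBereleP (standardize w) ≡ relabel (bereleP w) (cancelCount w))
    × ((γ : Γ n) → countT (bereleP w) γ + cancelCount w γ ≡ mult w γ)
lemma2p7 n _ w with std-run , ss , count ← Correspondence.stdBereleRun-label n w [] (λ _ → 0) [] (Correspondence.initial n) =
  cong (λ std → [] ∷ proj₂ std) std-run ,
  trans (cong proj₁ std-run) (trans (labelTab-cong′ P (λ γ → ℕ.+-identityʳ _)) (labelTab≡relabel (cancelCount w) P ss)) ,
  λ γ → trans (cong (countT P γ +_) (sym (ℕ.+-identityʳ _))) (count γ)
  where
  open Labelling n
  open Relabelling n
  P : Tableau (Γ n)
  P = bereleP w
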